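{- For every $n\ge1$, \[ \mathfrak{S}_{1^n} = \sum_{\alpha\models n}(-q)^{n-\ell(\alpha)}\,\mathcal{Q}'_\alpha, \] and more generally, for $1\le k\le n$, \[ \mathfrak{S}_{(k,1^{n-k})} = \sum_{\substack{\alpha\models n\\ \alpha_1\ge k}}(-q)^{n-k+1-\ell(\alpha)}\,\mathcal{Q}'_\alpha. \]
   Context: Work over $\mathbb{Q}(q)$. $\mathrm{NSym}$ is the free associative algebra on $H_1,H_2,\dots$ ($H_0=1$, $H_{ -r}=0$ for $r>0$), graded dual to $\mathrm{QSym}$ via $\langle H_{\alpha_1}\cdots H_{\alpha_k},M_\beta\rangle=\delta_{\alpha\beta}$ ($M_\beta$ monomial quasisymmetric functions), coproduct $\Delta(H_j)=\sum_iH_i\otimes H_{j-i}$. For $F\in\mathrm{QSym}$, $F^\perp$ satisfies $\langle F^\perp(H),G\rangle=\langle H,FG\rangle$. $F_i=\sum_{\gamma\models i}M_\gamma$ ($F_0=1$), $F_{1^i}=M_{1^i}$. Let $\mathbb{B}_m=\sum_{i\ge0}(-1)^iH_{m+i}F_{1^i}^\perp$, $\mathfrak{S}_\alpha=\mathbb{B}_{\alpha_1}\cdots\mathbb{B}_{\alpha_m}(1)$, $\widetilde{\mathbb{B}}_m(f)=\sum_{i\ge0}q^i\mathbb{B}_{m+i}(F_i^\perp(f))$, and $\mathcal{Q}'_\alpha=\widetilde{\mathbb{B}}_{\alpha_1}\cdots\widetilde{\mathbb{B}}_{\alpha_m}(1)$. $1^n$ is the composition $(1,\dots,1)$ with $n$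 parts and $(k,1^{n-k})$ is $(k,1,\dots,1)$; $\ell(\alpha)$ is the number of parts. -}

module Defs where

open import Data.Nat as ℕ using (ℕ; zero; suc; _≤ᵇ_; _∸_)
open import Data.Integer as ℤ using (ℤ; +_; -_)
open import Data.List using (List; []; _∷_; map; concatMap; foldr; replicate; length; filter; upTo; _++_)
open import Data.Bool using (Bool; true; false; if_then_else_; _∧_)
open import Relation.Nullary.Decidable using (⌊_⌋)
open import Relation.Binary.PropositionalEquality using (_≡_)
import Data.List.Properties as LP
open import Data.Nat.ListAction using (sum)

-- Compositions (lists of positive naturals) and their enumeration

Composition : Set
Composition = List ℕ

size : Composition → ℕ
size = sum

_≟c_ : (α β : Composition) → Bool
α ≟c β = ⌊ LP.≡-dec ℕ._≟_ α β ⌋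

bump : Composition → List Composition
bump []       = []
bump (x ∷ xs) = (suc x ∷ xs) ∷ []

comps : ℕ → List Composition
comps zero          = [] ∷ []
comps (suc zero)    = (1 ∷ []) ∷ []
comps (suc (suc n)) = concatMap (λ c → (1 ∷ c) ∷ bump c) (comps (suc n))

compsUpTo : ℕ → List Composition
compsUpTo N = concatMap comps (upTo (suc N))

-- Elements of NSym with coefficients in ℤ[q]:
-- a formal ℤ-linear combination of terms  c · q^k · H_α

record Term : Set where
  constructor term
  field
    coeff : ℤ
    qdeg  : ℕ
    word  : Composition
open Term public

NSym : Set
NSym = List Term

coeffOf : ℕ → Composition → NSym → ℤ
coeffOf k β [] = + 0
coeffOf k β (term c d α ∷ f) =
  (if ⌊ k ℕ.≟ d ⌋ ∧ (β ≟c α) then c else + 0) ℤ.+ coeffOf k β f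

infix 4 _≈_
_≈_ : NSym → NSym → Set
f ≈ g = ∀ (k : ℕ) (β : Composition) → coeffOf k β f ≡ coeffOf k β g

one : NSym
one = term (+ 1) 0 [] ∷ []

scale : ℤ → ℕ → NSym → NSym
scale c k = map (λ t → term (c ℤ.* coeff t) (k ℕ.+ qdeg t) (word t))

ext : (Composition → NSym) → NSym → NSym
ext φ = concatMap (λ t → scale (coeff t) (qdeg t) (φ (word t)))

sgn : ℕ → ℤ
sgn zero    = + 1
sgn (suc i) = - sgn i

-- left multiplication by H_m (H_0 = 1)
Hmul : ℕ → NSym → NSym
Hmul zero    f = f
Hmul (suc m) f = map (λ t → term (coeff t) (qdeg t) (suc m ∷ word t)) f

-- QSym: product of monomial quasisymmetric functions (quasi-shuffle)
-- M_a M_b = Σ_{c ∈ qsh a b} M_c  (with multiplicity)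

qsh : Composition → Composition → List Composition
qsh [] b = b ∷ []
qsh (x ∷ a) [] = (x ∷ a) ∷ []
qsh (x ∷ a) (y ∷ b) =
  map (x ∷_) (qsh a (y ∷ b)) ++ map (y ∷_) (qsh (x ∷ a) b)
    ++ map (x ℕ.+ y ∷_) (qsh a b)

count : Composition → List Composition → ℕ
count α = length ∘′ filter (λ c → LP.≡-dec ℕ._≟_ α c)
  where
  _∘′_ : {A B C : Set} → (B → C) → (A → B) → A → C
  (g ∘′ h) x = g (h x)

-- A quasisymmetric function F = Σ_{δ ∈ S} M_δ is given by the list S.
-- ⟨H_α, F · M_γ⟩ = coefficient of M_α in F · M_γ
pairFM : List Composition → Composition → Composition → ℕ
pairFM S α γ = sum (map (λ δ → count α (qsh δ γ)) S)

-- F^⊥ on the basis: F^⊥(H_α) = Σ_γ ⟨H_α, F M_γ⟩ H_γ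
-- (only |γ| ≤ |α| can contribute, by degree)
perpB : List Composition → Composition → NSym
perpB S α = map (λ γ → term (+ pairFM S α γ) 0 γ) (compsUpTo (size α))

perp : List Composition → NSym → NSym
perp S = ext (perpB S)

-- F_i = Σ_{γ ⊨ i} M_γ  and  F_{1^i} = M_{1^i}
Fi : ℕ → List Composition
Fi i = comps i

F1i : ℕ → List Composition
F1i i = replicate i 1 ∷ []

-- Operators B_m and B̃_m.  On H_α the sums over i ≥ 0 are finite:
-- F^⊥(H_α) = 0 as soon as deg F > |α|, so we sum over i ≤ |α|.

BB : ℕ → Composition → NSym
BB m α = concatMap (λ i → scale (sgn i) 0 (Hmul (m ℕ.+ i) (perpB (F1i i) α)))
                   (upTo (suc (size α)))

B : ℕ → NSym → NSym
B m = ext (BB m)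

BtB : ℕ → Composition → NSym
BtB m α = concatMap (λ i → scale (+ 1) i (B (m ℕ.+ i) (perpB (Fi i) α)))
                    (upTo (suc (size α)))

Bt : ℕ → NSym → NSym
Bt m = ext (BtB m)

𝔖 : Composition → NSym
𝔖 α = foldr B one α

Q′ : Composition → NSym
Q′ α = foldr Bt one α

negq : ℕ → NSym → NSym
negq e = scale (sgn e) e

firstPartGeq : ℕ → Composition → Bool
firstPartGeq k []      = false
firstPartGeq k (x ∷ _) = k ≤ᵇ x

rhsAll : ℕ → NSym
rhsAll n = concatMap (λ α → negq (n ∸ length α) (Q′ α)) (comps n)

-- Σ_{α ⊨ n, α₁ ≥ k} (-q)^{n-k+1-ℓ(α)} Q'_α   (exponent is ≥ 0 since α₁ ≥ k)
rhsHook : ℕ → ℕ → NSym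
rhsHook n k = concatMap
  (λ α → if firstPartGeq k α then negq (suc (n ∸ k) ∸ length α) (Q′ α) else [])
  (comps n)

-- Let Λ_m = ∑_{α ⊨ m} (-1)^{m-ℓ(α)} H_α. Pairing with the quasi-shuffle product gives
-- F_{1^j}^⊥ Λ_m = Λ_{m-j}, F_0^⊥ = id and F_i^⊥ Λ_m = 0 for i ≥ 2. The first fact yields
-- 𝔹_1 Λ_m = Λ_{m+1}, so 𝔖_{1^m} = Λ_m and 𝔖_{(k,1^m)} = 𝔹_k Λ_m. The others yield
-- 𝔹̃_c Λ_{r+1} = 𝔹_c Λ_{r+1} + q 𝔹_{c+1} Λ_r, which telescopes to
-- 𝔹_k Λ_m = ∑_{j ≤ m} (-q)^j 𝔹̃_{k+j} Λ_{m-j}. Grouping the α ⊨ n with α₁ ≥ k by α₁ = k + j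
-- writes the hook right-hand side as ∑_j (-q)^j 𝔹̃_{k+j} applied to the first right-hand side
-- for m - j, so by strong induction the first right-hand side for n is Λ_n, and both
-- identities follow.

module Submission where

open import Defs
open import Data.Nat as ℕ using (ℕ; zero; suc; _≤_; _<_; _∸_; z≤n; s≤s)
import Data.Nat.Properties as ℕP
import Data.Nat.Tactic.RingSolver as ℕS
open import Data.Nat.ListAction using (sum)
open import Data.Integer as ℤ using (ℤ; +_; -_; _+_; _*_; 0ℤ; 1ℤ)
import Data.Integer.Properties as ℤP
open import Data.Integer.Tactic.RingSolver using (solve-∀)
open import Data.Bool using (Bool; true; false; if_then_else_; _∧_)
open import Data.Bool.Properties using (T-≡)
open import Data.List using (List; []; _∷_; map; concatMap; length; upTo; applyUpTo; _++_; replicate)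
import Data.List.Properties as LP
open import Data.List.Relation.Unary.All as All using (All; []; _∷_)
import Data.List.Relation.Unary.All.Properties as AllP
open import Data.Product using (_×_; _,_; proj₁)
open import Data.Sum using (_⊎_; inj₁; inj₂)
open import Data.Empty using (⊥-elim)
open import Function using (_∘_)
open import Function.Bundles using (Equivalence)
open import Level using (0ℓ)
open import Relation.Nullary using (Dec; yes; no)
open import Relation.Nullary.Decidable using (⌊_⌋)
open import Relation.Binary.Definitions using (DecidableEquality)
open import Relation.Binary.Bundles using (Setoid)
open import Relation.Binary.PropositionalEquality hiding ([_])
import Relation.Binary.Reasoning.Setoid as SetoidReasoning

[_] : Bool → ℤ
[ true ]  = 1ℤ
[ false ] = 0ℤ

[]-∧ : ∀ a b c → (if a ∧ b then c else 0ℤ) ≡ [ a ] * ([ b ] * c)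
[]-∧ true  true  c = sym (trans (ℤP.*-identityˡ _) (ℤP.*-identityˡ c))
[]-∧ true  false c = refl
[]-∧ false b     c = refl

≤ᵇ-suc : ∀ m n → (suc m ℕ.≤ᵇ suc n) ≡ (m ℕ.≤ᵇ n)
≤ᵇ-suc zero    n = refl
≤ᵇ-suc (suc m) n = refl

≤ᵇ-true : ∀ {m n} → m ≤ n → (m ℕ.≤ᵇ n) ≡ true
≤ᵇ-true m≤n = Equivalence.to T-≡ (ℕP.≤⇒≤ᵇ m≤n)

≤ᵇ-false : ∀ {m n} → n < m → (m ℕ.≤ᵇ n) ≡ false
≤ᵇ-false {m} {n} n<m with m ℕ.≤ᵇ n in m≤ᵇn
... | false = refl
... | true  = ⊥-elim (ℕP.<⇒≱ n<m (ℕP.≤ᵇ⇒≤ m n (Equivalence.from T-≡ m≤ᵇn)))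

module Kronecker {A : Set} (_≟_ : DecidableEquality A) where

  δ : A → A → ℤ
  δ x y = [ ⌊ x ≟ y ⌋ ]

  δ-elim : ∀ x y (P : ℤ → Set) → (x ≡ y → P (1ℤ)) → (x ≢ y → P (0ℤ)) → P (δ x y)
  δ-elim x y P p≡ p≢ with x ≟ y
  ... | yes x≡y = p≡ x≡y
  ... | no  x≢y = p≢ x≢y

  δ-≡ : ∀ {x y} → x ≡ y → δ x y ≡ 1ℤ
  δ-≡ {x} {y} x≡y = δ-elim x y (_≡ 1ℤ) (λ _ → refl) (λ x≢y → ⊥-elim (x≢y x≡y))

  δ-≢ : ∀ {x y} → x ≢ y → δ x y ≡ 0ℤ
  δ-≢ {x} {y} x≢y = δ-elim x y (_≡ 0ℤ) (λ x≡y → ⊥-elim (x≢y x≡y)) (λ _ → refl)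

  δ-sym : ∀ x y → δ x y ≡ δ y x
  δ-sym x y = δ-elim x y (_≡ δ y x) (λ x≡y → sym (δ-≡ (sym x≡y))) (λ x≢y → sym (δ-≢ (x≢y ∘ sym)))

  δ-subst : ∀ x y (F : A → ℤ) → δ x y * F y ≡ δ x y * F x
  δ-subst x y F = δ-elim x y (λ d → d * F y ≡ d * F x) (λ { refl → refl }) (λ _ → refl)

open Kronecker ℕ._≟_ public using (δ; δ-elim; δ-≡; δ-≢)
open Kronecker (LP.≡-dec ℕ._≟_) public
  renaming (δ to δᶜ; δ-elim to δᶜ-elim; δ-≡ to δᶜ-≡; δ-≢ to δᶜ-≢; δ-sym to δᶜ-sym; δ-subst to δᶜ-subst)

δ-suc : ∀ x y → δ (suc x) (suc y) ≡ δ x y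
δ-suc x y = δ-elim x y (δ (suc x) (suc y) ≡_)
  (δ-≡ ∘ cong suc) (λ x≢y → δ-≢ (x≢y ∘ ℕP.suc-injective))

δ-∸ : ∀ x N y → [ x ℕ.≤ᵇ N ] * δ y (N ∸ x) ≡ δ (x ℕ.+ y) N
δ-∸ zero    N       y = ℤP.*-identityˡ (δ y N)
δ-∸ (suc x) zero    y = refl
δ-∸ (suc x) (suc N) y = trans (cong (λ b → [ b ] * δ y (N ∸ x)) (≤ᵇ-suc x N)) (trans (δ-∸ x N y) (sym (δ-suc (x ℕ.+ y) N)))

≤ᵇ-δ : ∀ {a b} m → a ≤ b → [ a ℕ.≤ᵇ m ] * δ b m ≡ δ b m
≤ᵇ-δ {a} {b} m a≤b = δ-elim b m (λ d → [ a ℕ.≤ᵇ m ] * d ≡ d)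
  (λ { refl → cong (λ t → [ t ] * 1ℤ) (≤ᵇ-true a≤b) })
  (λ _ → ℤP.*-zeroʳ [ a ℕ.≤ᵇ m ])

δᶜ-∷ : ∀ x α y β → δᶜ (x ∷ α) (y ∷ β) ≡ δ x y * δᶜ α β
δᶜ-∷ x α y β = δ-elim x y (λ d → δᶜ (x ∷ α) (y ∷ β) ≡ d * δᶜ α β)
  (λ { refl → δᶜ-elim α β (λ d → δᶜ (x ∷ α) (x ∷ β) ≡ 1ℤ * d)
                (λ { refl → δᶜ-≡ refl }) (λ α≢β → δᶜ-≢ (α≢β ∘ LP.∷-injectiveʳ)) })
  (λ x≢y → δᶜ-≢ (x≢y ∘ LP.∷-injectiveˡ))

∑ : {A : Set} → List A → (A → ℤ) → ℤ
∑ []       f = 0ℤ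
∑ (x ∷ xs) f = f x + ∑ xs f

syntax ∑ xs (λ x → e) = ∑[ x ∈ xs ] e

∑< : ℕ → (ℕ → ℤ) → ℤ
∑< zero    f = 0ℤ
∑< (suc n) f = f 0 + ∑< n (f ∘ suc)

syntax ∑< n (λ i → e) = ∑[ i < n ] e

module _ {A : Set} where

  ∑-++ : (xs ys : List A) (f : A → ℤ) → ∑ (xs ++ ys) f ≡ ∑ xs f + ∑ ys f
  ∑-++ []       ys f = sym (ℤP.+-identityˡ _)
  ∑-++ (x ∷ xs) ys f = trans (cong (_+_ (f x)) (∑-++ xs ys f)) (sym (ℤP.+-assoc (f x) _ _))

  ∑-cong : (xs : List A) {f g : A → ℤ} → (∀ x → f x ≡ g x) → ∑ xs f ≡ ∑ xs g
  ∑-cong []       f≗g = refl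
  ∑-cong (x ∷ xs) f≗g = cong₂ _+_ (f≗g x) (∑-cong xs f≗g)

  ∑-congᴬ : {P : A → Set} {xs : List A} {f g : A → ℤ} →
            All P xs → (∀ x → P x → f x ≡ g x) → ∑ xs f ≡ ∑ xs g
  ∑-congᴬ []         f≗g = refl
  ∑-congᴬ (px ∷ pxs) f≗g = cong₂ _+_ (f≗g _ px) (∑-congᴬ pxs f≗g)

  ∑-0 : (xs : List A) → ∑[ x ∈ xs ] 0ℤ ≡ 0ℤ
  ∑-0 []       = refl
  ∑-0 (x ∷ xs) = trans (ℤP.+-identityˡ _) (∑-0 xs)

  ∑-+ : (xs : List A) (f g : A → ℤ) → ∑[ x ∈ xs ] (f x + g x) ≡ ∑ xs f + ∑ xs g
  ∑-+ []       f g = refl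
  ∑-+ (x ∷ xs) f g = trans (cong (_+_ (f x + g x)) (∑-+ xs f g)) (interchange (f x) (g x) _ _)
    where
    interchange : ∀ a b c d → (a + b) + (c + d) ≡ (a + c) + (b + d)
    interchange = solve-∀

  ∑-*ˡ : (xs : List A) (c : ℤ) (f : A → ℤ) → ∑[ x ∈ xs ] (c * f x) ≡ c * ∑ xs f
  ∑-*ˡ []       c f = sym (ℤP.*-zeroʳ c)
  ∑-*ˡ (x ∷ xs) c f = trans (cong (_+_ (c * f x)) (∑-*ˡ xs c f)) (sym (ℤP.*-distribˡ-+ c (f x) _))

  ∑-map : {B : Set} (g : B → A) (xs : List B) (f : A → ℤ) → ∑ (map g xs) f ≡ ∑[ x ∈ xs ] f (g x)
  ∑-map g []       f = refl
  ∑-map g (x ∷ xs) f = cong (_+_ (f (g x))) (∑-map g xs f)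

  ∑-concatMap : {B : Set} (g : B → List A) (xs : List B) (f : A → ℤ) →
                ∑ (concatMap g xs) f ≡ ∑[ x ∈ xs ] ∑ (g x) f
  ∑-concatMap g []       f = refl
  ∑-concatMap g (x ∷ xs) f = trans (∑-++ (g x) _ f) (cong (_+_ (∑ (g x) f)) (∑-concatMap g xs f))

∑-comm : {A B : Set} (xs : List A) (ys : List B) (f : A → B → ℤ) →
         ∑[ x ∈ xs ] ∑[ y ∈ ys ] f x y ≡ ∑[ y ∈ ys ] ∑[ x ∈ xs ] f x y
∑-comm []       ys f = sym (∑-0 ys)
∑-comm (x ∷ xs) ys f = trans (cong (_+_ (∑ ys (f x))) (∑-comm xs ys f)) (sym (∑-+ ys (f x) _))

∑<-cong : ∀ n {f g : ℕ → ℤ} → (∀ i → f i ≡ g i) → ∑< n f ≡ ∑< n g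
∑<-cong zero    f≗g = refl
∑<-cong (suc n) f≗g = cong₂ _+_ (f≗g 0) (∑<-cong n (f≗g ∘ suc))

∑<-congᴮ : ∀ n {f g : ℕ → ℤ} → (∀ i → i < n → f i ≡ g i) → ∑< n f ≡ ∑< n g
∑<-congᴮ zero    f≗g = refl
∑<-congᴮ (suc n) f≗g = cong₂ _+_ (f≗g 0 (s≤s z≤n)) (∑<-congᴮ n (λ i i<n → f≗g (suc i) (s≤s i<n)))

∑<-0 : ∀ n → ∑[ i < n ] 0ℤ ≡ 0ℤ
∑<-0 zero    = refl
∑<-0 (suc n) = trans (ℤP.+-identityˡ _) (∑<-0 n)

∑<-+ : ∀ n (f g : ℕ → ℤ) → ∑[ i < n ] (f i + g i) ≡ ∑< n f + ∑< n g
∑<-+ zero    f g = refl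
∑<-+ (suc n) f g = trans (cong (_+_ (f 0 + g 0)) (∑<-+ n _ _)) (interchange (f 0) (g 0) _ _)
  where
  interchange : ∀ a b c d → (a + b) + (c + d) ≡ (a + c) + (b + d)
  interchange = solve-∀

∑<-*ˡ : ∀ n (c : ℤ) (f : ℕ → ℤ) → ∑[ i < n ] (c * f i) ≡ c * ∑< n f
∑<-*ˡ zero    c f = sym (ℤP.*-zeroʳ c)
∑<-*ˡ (suc n) c f = trans (cong (_+_ (c * f 0)) (∑<-*ˡ n c _)) (sym (ℤP.*-distribˡ-+ c (f 0) _))

∑-∑<-comm : {A : Set} (xs : List A) (n : ℕ) (f : A → ℕ → ℤ) →
            ∑[ x ∈ xs ] ∑[ i < n ] f x i ≡ ∑[ i < n ] ∑[ x ∈ xs ] f x i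
∑-∑<-comm []       n f = sym (∑<-0 n)
∑-∑<-comm (x ∷ xs) n f = trans (cong (_+_ (∑< n (f x))) (∑-∑<-comm xs n f)) (sym (∑<-+ n (f x) _))

∑-applyUpTo : ∀ (g : ℕ → ℕ) n (f : ℕ → ℤ) → ∑ (applyUpTo g n) f ≡ ∑[ i < n ] f (g i)
∑-applyUpTo g zero    f = refl
∑-applyUpTo g (suc n) f = cong (_+_ (f (g 0))) (∑-applyUpTo (g ∘ suc) n f)

∑-upTo : ∀ n (f : ℕ → ℤ) → ∑ (upTo n) f ≡ ∑< n f
∑-upTo = ∑-applyUpTo (λ i → i)

∑<-+-split : ∀ a n f → ∑< (a ℕ.+ n) f ≡ ∑< a f + ∑[ j < n ] f (a ℕ.+ j)
∑<-+-split zero    n f = sym (ℤP.+-identityˡ (∑< n f))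
∑<-+-split (suc a) n f = trans (cong (_+_ (f 0)) (∑<-+-split a n (f ∘ suc))) (sym (ℤP.+-assoc (f 0) _ _))

∑<-δ : ∀ N x (A : ℕ → ℤ) → ∑[ p < suc N ] (δ x p * A p) ≡ [ x ℕ.≤ᵇ N ] * A x
∑<-δ zero    zero    A = ℤP.+-identityʳ _
∑<-δ zero    (suc x) A = refl
∑<-δ (suc N) zero    A = trans (cong (_+_ (1ℤ * A 0)) (∑<-0 (suc N))) (ℤP.+-identityʳ _)
∑<-δ (suc N) (suc x) A =
  trans (ℤP.+-identityˡ _) (trans (∑<-cong (suc N) (λ p → cong (_* A (suc p)) (δ-suc x p)))
                           (trans (∑<-δ N x (A ∘ suc)) (cong (λ b → [ b ] * A (suc x)) (sym (≤ᵇ-suc x N)))))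

∑<-telescope : ∀ M (T U : ℕ → ℤ) → (∀ j → j < M → U j ≡ T j + - T (suc j)) → U M ≡ T M →
               ∑< (suc M) U ≡ T 0
∑<-telescope zero    T U step last = trans (ℤP.+-identityʳ (U 0)) last
∑<-telescope (suc M) T U step last =
  trans (cong₂ _+_ (step 0 (s≤s z≤n)) (∑<-telescope M (T ∘ suc) (U ∘ suc) (λ j j<M → step (suc j) (s≤s j<M)) last))
        (cancel (T 0) (T 1))
  where
  cancel : ∀ a b → (a + - b) + b ≡ a
  cancel = solve-∀

Coeffs : Set
Coeffs = ℕ → Composition → ℤ

⟦_⟧ : NSym → Coeffs
⟦ f ⟧ k β = coeffOf k β f

⟦_⟧ᵗ : Term → Coeffs
⟦ t ⟧ᵗ k β = if ⌊ k ℕ.≟ qdeg t ⌋ ∧ (β ≟c word t) then coeff t else 0ℤ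

⟦term⟧ : ∀ c d α k β → ⟦ term c d α ⟧ᵗ k β ≡ δ k d * (δᶜ β α * c)
⟦term⟧ c d α k β = []-∧ ⌊ k ℕ.≟ d ⌋ (β ≟c α) c

⟦∷⟧ : ∀ c d α f k β → ⟦ term c d α ∷ f ⟧ k β ≡ δ k d * (δᶜ β α * c) + ⟦ f ⟧ k β
⟦∷⟧ c d α f k β = cong (_+ ⟦ f ⟧ k β) (⟦term⟧ c d α k β)

⟦++⟧ : ∀ f g k β → ⟦ f ++ g ⟧ k β ≡ ⟦ f ⟧ k β + ⟦ g ⟧ k β
⟦++⟧ []      g k β = sym (ℤP.+-identityˡ _)
⟦++⟧ (t ∷ f) g k β =
  trans (cong (_+_ (⟦ t ⟧ᵗ k β)) (⟦++⟧ f g k β)) (sym (ℤP.+-assoc (⟦ t ⟧ᵗ k β) _ _))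

⟦concatMap⟧ : {A : Set} (h : A → NSym) (xs : List A) → ∀ k β →
              ⟦ concatMap h xs ⟧ k β ≡ ∑[ x ∈ xs ] ⟦ h x ⟧ k β
⟦concatMap⟧ h []       k β = refl
⟦concatMap⟧ h (x ∷ xs) k β = trans (⟦++⟧ (h x) _ k β) (cong (_+_ (⟦ h x ⟧ k β)) (⟦concatMap⟧ h xs k β))

⟦⟧-∑ : ∀ f k β → ⟦ f ⟧ k β ≡ ∑[ t ∈ f ] (δ k (qdeg t) * (δᶜ β (word t) * coeff t))
⟦⟧-∑ []                k β = refl
⟦⟧-∑ (term c d α ∷ f) k β = cong₂ _+_ (⟦term⟧ c d α k β) (⟦⟧-∑ f k β)

⟦map-term⟧ : {A : Set} (c : A → ℤ) (d : A → ℕ) (w : A → Composition) (xs : List A) → ∀ k β →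
             ⟦ map (λ x → term (c x) (d x) (w x)) xs ⟧ k β ≡ ∑[ x ∈ xs ] (δ k (d x) * (δᶜ β (w x) * c x))
⟦map-term⟧ c d w xs k β = trans (⟦⟧-∑ (map (λ x → term (c x) (d x) (w x)) xs) k β) (∑-map _ xs _)

-- Multiplication by q^d.
shift : ℕ → Coeffs → Coeffs
shift zero    F k       β = F k β
shift (suc d) F zero    β = 0ℤ
shift (suc d) F (suc k) β = shift d F k β

shift-cong : ∀ d {F G : Coeffs} → (∀ k β → F k β ≡ G k β) → ∀ k β → shift d F k β ≡ shift d G k β
shift-cong zero    F≗G k       β = F≗G k β
shift-cong (suc d) F≗G zero    β = refl
shift-cong (suc d) F≗G (suc k) β = shift-cong d F≗G k β

shift-0 : ∀ d k β → shift d (λ _ _ → 0ℤ) k β ≡ 0ℤ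
shift-0 zero    k       β = refl
shift-0 (suc d) zero    β = refl
shift-0 (suc d) (suc k) β = shift-0 d k β

shift-+ : ∀ d (F G : Coeffs) k β → shift d (λ k′ β′ → F k′ β′ + G k′ β′) k β ≡ shift d F k β + shift d G k β
shift-+ zero    F G k       β = refl
shift-+ (suc d) F G zero    β = refl
shift-+ (suc d) F G (suc k) β = shift-+ d F G k β

shift-∑ : ∀ d {A : Set} (xs : List A) (c : A → ℤ) (F : A → Coeffs) → ∀ k β →
          shift d (λ k′ β′ → ∑[ x ∈ xs ] (c x * F x k′ β′)) k β ≡ ∑[ x ∈ xs ] (c x * shift d (F x) k β)
shift-∑ zero    xs c F k       β = refl
shift-∑ (suc d) xs c F zero    β = sym (trans (∑-cong xs (ℤP.*-zeroʳ ∘ c)) (∑-0 xs))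
shift-∑ (suc d) xs c F (suc k) β = shift-∑ d xs c F k β

shift-shift : ∀ d e F k β → shift (d ℕ.+ e) F k β ≡ shift d (shift e F) k β
shift-shift zero    e F k       β = refl
shift-shift (suc d) e F zero    β = refl
shift-shift (suc d) e F (suc k) β = shift-shift d e F k β

⟦scale-0⟧ : ∀ c f k β → ⟦ scale c 0 f ⟧ k β ≡ c * ⟦ f ⟧ k β
⟦scale-0⟧ c []                 k β = sym (ℤP.*-zeroʳ c)
⟦scale-0⟧ c (term c′ e α ∷ f) k β = begin
  ⟦ term (c * c′) e α ∷ scale c 0 f ⟧ k β           ≡⟨ ⟦∷⟧ (c * c′) e α (scale c 0 f) k β ⟩
  δ k e * (δᶜ β α * (c * c′)) + ⟦ scale c 0 f ⟧ k β ≡⟨ cong (_+_ (δ k e * (δᶜ β α * (c * c′)))) (⟦scale-0⟧ c f k β) ⟩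
  δ k e * (δᶜ β α * (c * c′)) + c * ⟦ f ⟧ k β       ≡⟨ pull (δ k e) (δᶜ β α) c c′ (⟦ f ⟧ k β) ⟩
  c * (δ k e * (δᶜ β α * c′) + ⟦ f ⟧ k β)           ≡⟨ cong (c *_) (sym (⟦∷⟧ c′ e α f k β)) ⟩
  c * ⟦ term c′ e α ∷ f ⟧ k β                        ∎
  where
  open ≡-Reasoning
  pull : ∀ a b c c′ v → a * (b * (c * c′)) + c * v ≡ c * (a * (b * c′) + v)
  pull = solve-∀

⟦scale⟧ : ∀ c d f k β → ⟦ scale c d f ⟧ k β ≡ c * shift d ⟦ f ⟧ k β
⟦scale⟧ c zero    f k       β = ⟦scale-0⟧ c f k β
⟦scale⟧ c (suc d) f zero    β = trans (lowest f) (sym (ℤP.*-zeroʳ c))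
  where
  lowest : ∀ f → ⟦ scale c (suc d) f ⟧ 0 β ≡ 0ℤ
  lowest []                 = refl
  lowest (term c′ e α ∷ f) = trans (⟦∷⟧ (c * c′) (suc (d ℕ.+ e)) α (scale c (suc d) f) 0 β) (trans (ℤP.+-identityˡ _) (lowest f))
⟦scale⟧ c (suc d) f (suc k) β = trans (lower f) (⟦scale⟧ c d f k β)
  where
  lower : ∀ f → ⟦ scale c (suc d) f ⟧ (suc k) β ≡ ⟦ scale c d f ⟧ k β
  lower []                 = refl
  lower (term c′ e α ∷ f) = begin
    ⟦ scale c (suc d) (term c′ e α ∷ f) ⟧ (suc k) β
      ≡⟨ ⟦∷⟧ (c * c′) (suc (d ℕ.+ e)) α (scale c (suc d) f) (suc k) β ⟩
    δ (suc k) (suc (d ℕ.+ e)) * (δᶜ β α * (c * c′)) + ⟦ scale c (suc d) f ⟧ (suc k) β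
      ≡⟨ cong₂ (λ x y → x * (δᶜ β α * (c * c′)) + y) (δ-suc k (d ℕ.+ e)) (lower f) ⟩
    δ k (d ℕ.+ e) * (δᶜ β α * (c * c′)) + ⟦ scale c d f ⟧ k β
      ≡⟨ sym (⟦∷⟧ (c * c′) (d ℕ.+ e) α (scale c d f) k β) ⟩
    ⟦ scale c d (term c′ e α ∷ f) ⟧ k β ∎
    where open ≡-Reasoning

H-prefix : ℕ → Coeffs → Coeffs
H-prefix a F k []      = 0ℤ
H-prefix a F k (x ∷ β) = δ x (suc a) * F k β

⟦Hmul⟧ : ∀ a f k β → ⟦ Hmul (suc a) f ⟧ k β ≡ H-prefix a ⟦ f ⟧ k β
⟦Hmul⟧ a f k β = trans (⟦map-term⟧ coeff qdeg (λ t → suc a ∷ word t) f k β) (prefix β)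
  where
  prefix : ∀ β → ∑[ t ∈ f ] (δ k (qdeg t) * (δᶜ β (suc a ∷ word t) * coeff t)) ≡ H-prefix a ⟦ f ⟧ k β
  prefix []      = trans (∑-cong f (λ t → ℤP.*-zeroʳ (δ k (qdeg t)))) (∑-0 f)
  prefix (x ∷ β) = begin
    ∑[ t ∈ f ] (δ k (qdeg t) * (δᶜ (x ∷ β) (suc a ∷ word t) * coeff t))
      ≡⟨ ∑-cong f (λ t → trans (cong (λ z → δ k (qdeg t) * (z * coeff t)) (δᶜ-∷ x β (suc a) (word t)))
                               (swap (δ k (qdeg t)) (δ x (suc a)) (δᶜ β (word t)) (coeff t))) ⟩
    ∑[ t ∈ f ] (δ x (suc a) * (δ k (qdeg t) * (δᶜ β (word t) * coeff t)))
      ≡⟨ ∑-*ˡ f (δ x (suc a)) _ ⟩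
    δ x (suc a) * ∑[ t ∈ f ] (δ k (qdeg t) * (δᶜ β (word t) * coeff t))
      ≡⟨ cong (δ x (suc a) *_) (sym (⟦⟧-∑ f k β)) ⟩
    δ x (suc a) * ⟦ f ⟧ k β ∎
    where
    open ≡-Reasoning
    swap : ∀ a b c d → a * ((b * c) * d) ≡ b * (a * (c * d))
    swap = solve-∀

pairing : Coeffs → NSym → ℤ
pairing G f = ∑[ t ∈ f ] (coeff t * G (qdeg t) (word t))

⟦ext⟧ : ∀ φ f k β → ⟦ ext φ f ⟧ k β ≡ pairing (λ d α → shift d ⟦ φ α ⟧ k β) f
⟦ext⟧ φ f k β = trans (⟦concatMap⟧ _ f k β) (∑-cong f (λ t → ⟦scale⟧ (coeff t) (qdeg t) (φ (word t)) k β))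

module _ (d : ℕ) (α : Composition) where

  private
    removeStep : ∀ {e γ} → Dec (d ≡ e) → Dec (α ≡ γ) → Term → NSym → NSym
    removeStep (yes _) (yes _) t r = r
    removeStep _       _       t r = t ∷ r

  remove : NSym → NSym
  remove []      = []
  remove (t ∷ h) = removeStep (d ℕ.≟ qdeg t) (LP.≡-dec ℕ._≟_ α (word t)) t (remove h)

  length-remove : ∀ h → length (remove h) ≤ length h
  length-remove []      = z≤n
  length-remove (t ∷ h) = step (d ℕ.≟ qdeg t) (LP.≡-dec ℕ._≟_ α (word t))
    where
    step : ∀ (d≟ : Dec (d ≡ qdeg t)) (α≟ : Dec (α ≡ word t)) → length (removeStep d≟ α≟ t (remove h)) ≤ suc (length h)
    step (yes _) (yes _) = ℕP.m≤n⇒m≤1+n (length-remove h)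
    step (yes _) (no  _) = s≤s (length-remove h)
    step (no  _) _       = s≤s (length-remove h)

  remove-self : ∀ t h → qdeg t ≡ d → word t ≡ α → remove (t ∷ h) ≡ remove h
  remove-self t h refl refl = step (d ℕ.≟ d) (LP.≡-dec ℕ._≟_ α α)
    where
    step : ∀ (d≟ : Dec (d ≡ d)) (α≟ : Dec (α ≡ α)) → removeStep d≟ α≟ t (remove h) ≡ remove h
    step (yes _) (yes _)  = refl
    step (yes _) (no α≢α) = ⊥-elim (α≢α refl)
    step (no d≢d) _       = ⊥-elim (d≢d refl)

  pairing-remove : ∀ G h → pairing G h ≡ G d α * ⟦ h ⟧ d α + pairing G (remove h)
  pairing-remove G []                 = sym (cong (_+ 0ℤ) (ℤP.*-zeroʳ (G d α)))
  pairing-remove G (term c e γ ∷ h) =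
    trans (cong (_+_ (c * G e γ)) (pairing-remove G h))
          (trans (step (d ℕ.≟ e) (LP.≡-dec ℕ._≟_ α γ))
                 (cong (λ z → G d α * z + pairing G (remove (term c e γ ∷ h))) (sym (⟦∷⟧ c e γ h d α))))
    where
    step : ∀ (d≟ : Dec (d ≡ e)) (α≟ : Dec (α ≡ γ)) →
           c * G e γ + (G d α * ⟦ h ⟧ d α + pairing G (remove h))
           ≡ G d α * ([ ⌊ d≟ ⌋ ] * ([ ⌊ α≟ ⌋ ] * c) + ⟦ h ⟧ d α) + pairing G (removeStep d≟ α≟ (term c e γ) (remove h))
    step (yes refl) (yes refl) = absorb c (G d α) (⟦ h ⟧ d α) (pairing G (remove h))
      where
      absorb : ∀ c g v p → c * g + (g * v + p) ≡ g * (1ℤ * (1ℤ * c) + v) + p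
      absorb = solve-∀
    step (yes refl) (no _)     = keep c (G d α) (G e γ) (⟦ h ⟧ d α) (pairing G (remove h))
      where
      keep : ∀ c g g′ v p → c * g′ + (g * v + p) ≡ g * (1ℤ * (0ℤ * c) + v) + (c * g′ + p)
      keep = solve-∀
    step (no _)     α≟         = keep [ ⌊ α≟ ⌋ ] c (G d α) (G e γ) (⟦ h ⟧ d α) (pairing G (remove h))
      where
      keep : ∀ b c g g′ v p → c * g′ + (g * v + p) ≡ g * (0ℤ * (b * c) + v) + (c * g′ + p)
      keep = solve-∀

  ⟦remove⟧-removed : ∀ h → ⟦ remove h ⟧ d α ≡ 0ℤ
  ⟦remove⟧-removed []                 = refl
  ⟦remove⟧-removed (term c e γ ∷ h) = step (d ℕ.≟ e) (LP.≡-dec ℕ._≟_ α γ)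
    where
    step : ∀ (d≟ : Dec (d ≡ e)) (α≟ : Dec (α ≡ γ)) → ⟦ removeStep d≟ α≟ (term c e γ) (remove h) ⟧ d α ≡ 0ℤ
    step (yes _)    (yes _)   = ⟦remove⟧-removed h
    step (yes refl) (no α≢γ) = begin
      ⟦ term c d γ ∷ remove h ⟧ d α           ≡⟨ ⟦∷⟧ c d γ (remove h) d α ⟩
      δ d d * (δᶜ α γ * c) + ⟦ remove h ⟧ d α ≡⟨ cong₂ (λ x y → δ d d * (x * c) + y) (δᶜ-≢ α≢γ) (⟦remove⟧-removed h) ⟩
      δ d d * 0ℤ + 0ℤ                         ≡⟨ trans (ℤP.+-identityʳ _) (ℤP.*-zeroʳ (δ d d)) ⟩
      0ℤ                                      ∎
      where open ≡-Reasoning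
    step (no d≢e)   _         = trans (⟦∷⟧ c e γ (remove h) d α)
      (cong₂ (λ x y → x * (δᶜ α γ * c) + y) (δ-≢ d≢e) (⟦remove⟧-removed h))

  ⟦remove⟧-other : ∀ {k β} → k ≢ d ⊎ β ≢ α → ∀ h → ⟦ remove h ⟧ k β ≡ ⟦ h ⟧ k β
  ⟦remove⟧-other {k} {β} k≢d⊎β≢α []                 = refl
  ⟦remove⟧-other {k} {β} k≢d⊎β≢α (term c e γ ∷ h) = step (d ℕ.≟ e) (LP.≡-dec ℕ._≟_ α γ)
    where
    IH : ⟦ remove h ⟧ k β ≡ ⟦ h ⟧ k β
    IH = ⟦remove⟧-other k≢d⊎β≢α h
    step : ∀ (d≟ : Dec (d ≡ e)) (α≟ : Dec (α ≡ γ)) →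
           ⟦ removeStep d≟ α≟ (term c e γ) (remove h) ⟧ k β ≡ ⟦ term c e γ ∷ h ⟧ k β
    step (yes refl) (yes refl) =
      trans IH (sym (trans (⟦∷⟧ c d α h k β) (trans (cong (_+ ⟦ h ⟧ k β) (vanish k≢d⊎β≢α)) (ℤP.+-identityˡ _))))
      where
      vanish : k ≢ d ⊎ β ≢ α → δ k d * (δᶜ β α * c) ≡ 0ℤ
      vanish (inj₁ k≢d) = cong (_* (δᶜ β α * c)) (δ-≢ k≢d)
      vanish (inj₂ β≢α) = trans (cong (λ x → δ k d * (x * c)) (δᶜ-≢ β≢α)) (ℤP.*-zeroʳ (δ k d))
    step (yes _) (no _) = cong (_+_ (⟦ term c e γ ⟧ᵗ k β)) IH
    step (no _)  _      = cong (_+_ (⟦ term c e γ ⟧ᵗ k β)) IH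

  ⟦remove⟧-zero : ∀ h → (∀ k β → ⟦ h ⟧ k β ≡ 0ℤ) → ∀ k β → ⟦ remove h ⟧ k β ≡ 0ℤ
  ⟦remove⟧-zero h h≈0 k β with k ℕ.≟ d | LP.≡-dec ℕ._≟_ β α
  ... | yes refl | yes refl = ⟦remove⟧-removed h
  ... | yes _    | no β≢α   = trans (⟦remove⟧-other (inj₂ β≢α) h) (h≈0 k β)
  ... | no k≢d   | _        = trans (⟦remove⟧-other (inj₁ k≢d) h) (h≈0 k β)

-- Strip off the terms of one monomial q^d H_α at a time: their coefficients sum to 0.
pairing-zero : ∀ G n h → length h ≤ n → (∀ k β → ⟦ h ⟧ k β ≡ 0ℤ) → pairing G h ≡ 0ℤ
pairing-zero G n       []      _         h≈0 = refl
pairing-zero G (suc n) (t ∷ h) (s≤s h≤n) h≈0 = begin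
  pairing G (t ∷ h)                                     ≡⟨ pairing-remove d α G (t ∷ h) ⟩
  G d α * ⟦ t ∷ h ⟧ d α + pairing G (remove d α (t ∷ h)) ≡⟨ cong₂ _+_ (trans (cong (G d α *_) (h≈0 d α)) (ℤP.*-zeroʳ (G d α)))
                                                                      (cong (pairing G) tail) ⟩
  0ℤ + pairing G (remove d α h)                         ≡⟨ ℤP.+-identityˡ _ ⟩
  pairing G (remove d α h)                              ≡⟨ pairing-zero G n (remove d α h) (ℕP.≤-trans (length-remove d α h) h≤n) rest≈0 ⟩
  0ℤ                                                    ∎
  where
  open ≡-Reasoning
  d : ℕ
  d = qdeg t
  α : Composition
  α = word t
  tail : remove d α (t ∷ h) ≡ remove d α h
  tail = remove-self d α t h refl refl
  rest≈0 : ∀ k β → ⟦ remove d α h ⟧ k β ≡ 0ℤ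
  rest≈0 k β = trans (cong (λ r → ⟦ r ⟧ k β) (sym tail)) (⟦remove⟧-zero d α (t ∷ h) h≈0 k β)

pairing-resp-≈ : ∀ G f g → f ≈ g → pairing G f ≡ pairing G g
pairing-resp-≈ G f g f≈g = ℤP.i-j≡0⇒i≡j (pairing G f) (pairing G g) (begin
  pairing G f ℤ.- pairing G g                        ≡⟨ cong (_+_ (pairing G f)) (sym (pairing-negate g)) ⟩
  pairing G f + pairing G (negate g)                 ≡⟨ sym (∑-++ f (negate g) _) ⟩
  pairing G (f ++ negate g)                          ≡⟨ pairing-zero G _ (f ++ negate g) ℕP.≤-refl difference≈0 ⟩
  0ℤ                                                 ∎)
  where
  open ≡-Reasoning
  negate : NSym → NSym
  negate = scale (- 1ℤ) 0
  pairing-negate : ∀ h → pairing G (negate h) ≡ - pairing G h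
  pairing-negate []                 = refl
  pairing-negate (term c e γ ∷ h) =
    trans (cong (_+_ ((- 1ℤ * c) * G e γ)) (pairing-negate h)) (neg-+ c (G e γ) (pairing G h))
    where
    neg-+ : ∀ c g p → (- 1ℤ * c) * g + - p ≡ - (c * g + p)
    neg-+ = solve-∀
  difference≈0 : ∀ k β → ⟦ f ++ negate g ⟧ k β ≡ 0ℤ
  difference≈0 k β = begin
    ⟦ f ++ negate g ⟧ k β         ≡⟨ ⟦++⟧ f (negate g) k β ⟩
    ⟦ f ⟧ k β + ⟦ negate g ⟧ k β  ≡⟨ cong₂ _+_ (f≈g k β) (⟦scale-0⟧ (- 1ℤ) g k β) ⟩
    ⟦ g ⟧ k β + - 1ℤ * ⟦ g ⟧ k β  ≡⟨ cancel (⟦ g ⟧ k β) ⟩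
    0ℤ                            ∎
    where
    cancel : ∀ v → v + - 1ℤ * v ≡ 0ℤ
    cancel = solve-∀

≈-setoid : Setoid 0ℓ 0ℓ
≈-setoid = record
  { Carrier       = NSym
  ; _≈_           = _≈_
  ; isEquivalence = record
    { refl  = λ k β → refl
    ; sym   = λ f≈g k β → sym (f≈g k β)
    ; trans = λ f≈g g≈h k β → trans (f≈g k β) (g≈h k β)
    }
  }

ext-cong : ∀ φ f g → f ≈ g → ext φ f ≈ ext φ g
ext-cong φ f g f≈g k β =
  trans (⟦ext⟧ φ f k β) (trans (pairing-resp-≈ (λ d α → shift d ⟦ φ α ⟧ k β) f g f≈g) (sym (⟦ext⟧ φ g k β)))

scale-cong : ∀ c d f g → f ≈ g → scale c d f ≈ scale c d g
scale-cong c d f g f≈g k β =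
  trans (⟦scale⟧ c d f k β) (trans (cong (c *_) (shift-cong d f≈g k β)) (sym (⟦scale⟧ c d g k β)))

concatMap-cong : {A : Set} (h h′ : A → NSym) (xs : List A) → (∀ x → h x ≈ h′ x) → concatMap h xs ≈ concatMap h′ xs
concatMap-cong h h′ xs h≈h′ k β =
  trans (⟦concatMap⟧ h xs k β) (trans (∑-cong xs (λ x → h≈h′ x k β)) (sym (⟦concatMap⟧ h′ xs k β)))

⟦ext-concatMap⟧ : ∀ φ {A : Set} (h : A → NSym) (xs : List A) → ∀ k β →
                  ⟦ ext φ (concatMap h xs) ⟧ k β ≡ ∑[ x ∈ xs ] ⟦ ext φ (h x) ⟧ k β
⟦ext-concatMap⟧ φ h []       k β = refl
⟦ext-concatMap⟧ φ h (x ∷ xs) k β = begin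
  ⟦ ext φ (h x ++ concatMap h xs) ⟧ k β
    ≡⟨ ⟦ext⟧ φ (h x ++ concatMap h xs) k β ⟩
  pairing G (h x ++ concatMap h xs)
    ≡⟨ ∑-++ (h x) (concatMap h xs) _ ⟩
  pairing G (h x) + pairing G (concatMap h xs)
    ≡⟨ cong₂ _+_ (sym (⟦ext⟧ φ (h x) k β)) (trans (sym (⟦ext⟧ φ (concatMap h xs) k β)) (⟦ext-concatMap⟧ φ h xs k β)) ⟩
  ⟦ ext φ (h x) ⟧ k β + ∑[ y ∈ xs ] ⟦ ext φ (h y) ⟧ k β ∎
  where
  open ≡-Reasoning
  G : Coeffs
  G d α = shift d ⟦ φ α ⟧ k β

⟦ext-scale⟧ : ∀ φ c d f k β → ⟦ ext φ (scale c d f) ⟧ k β ≡ c * shift d ⟦ ext φ f ⟧ k β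
⟦ext-scale⟧ φ c d f k β = begin
  ⟦ ext φ (scale c d f) ⟧ k β
    ≡⟨ trans (⟦ext⟧ φ (scale c d f) k β) (∑-map _ f _) ⟩
  ∑[ t ∈ f ] ((c * coeff t) * shift (d ℕ.+ qdeg t) ⟦ φ (word t) ⟧ k β)
    ≡⟨ ∑-cong f (λ t → trans (cong ((c * coeff t) *_) (shift-shift d (qdeg t) _ k β)) (ℤP.*-assoc c (coeff t) _)) ⟩
  ∑[ t ∈ f ] (c * (coeff t * shift d (shift (qdeg t) ⟦ φ (word t) ⟧) k β))
    ≡⟨ ∑-*ˡ f c _ ⟩
  c * ∑[ t ∈ f ] (coeff t * shift d (shift (qdeg t) ⟦ φ (word t) ⟧) k β)
    ≡⟨ cong (c *_) (sym (shift-∑ d f coeff (λ t → shift (qdeg t) ⟦ φ (word t) ⟧) k β)) ⟩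
  c * shift d (λ k′ β′ → pairing (λ e α → shift e ⟦ φ α ⟧ k′ β′) f) k β
    ≡⟨ cong (c *_) (shift-cong d (λ k′ β′ → sym (⟦ext⟧ φ f k′ β′)) k β) ⟩
  c * shift d ⟦ ext φ f ⟧ k β ∎
  where open ≡-Reasoning

allPositive : Composition → Bool
allPositive []            = true
allPositive (zero  ∷ α) = false
allPositive (suc _ ∷ α) = allPositive α

IsCompositionOf : ℕ → Composition → Set
IsCompositionOf n α = allPositive α ≡ true × size α ≡ n

comps-sound : ∀ n → All (IsCompositionOf n) (comps n)
comps-sound zero          = (refl , refl) ∷ []
comps-sound (suc zero)    = (refl , refl) ∷ []
comps-sound (suc (suc n)) = AllP.concat⁺ (AllP.map⁺ (All.map extend (comps-sound (suc n))))
  where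
  extend : ∀ {c} → IsCompositionOf (suc n) c → All (IsCompositionOf (suc (suc n))) ((1 ∷ c) ∷ bump c)
  extend {[]}        (_ , ())
  extend {zero ∷ c}  (() , _)
  extend {suc x ∷ c} (pos , sz) = (pos , cong suc sz) ∷ (pos , cong suc sz) ∷ []

∑-comps-suc : ∀ N (F : Composition → ℤ) →
              ∑ (comps (suc N)) F ≡ ∑[ p < suc N ] ∑[ β ∈ comps (N ∸ p) ] F (suc p ∷ β)
∑-comps-suc zero    F = sym (ℤP.+-identityʳ _)
∑-comps-suc (suc N) F = begin
  ∑ (comps (suc (suc N))) F
    ≡⟨ ∑-concatMap (λ c → (1 ∷ c) ∷ bump c) (comps (suc N)) F ⟩
  ∑[ c ∈ comps (suc N) ] (F (1 ∷ c) + ∑ (bump c) F)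
    ≡⟨ ∑-+ (comps (suc N)) (λ c → F (1 ∷ c)) (λ c → ∑ (bump c) F) ⟩
  ∑[ c ∈ comps (suc N) ] F (1 ∷ c) + ∑[ c ∈ comps (suc N) ] ∑ (bump c) F
    ≡⟨ cong (_+_ (∑[ c ∈ comps (suc N) ] F (1 ∷ c))) (trans (∑-comps-suc N (λ c → ∑ (bump c) F))
         (∑<-cong (suc N) (λ p → ∑-cong (comps (N ∸ p)) (λ β → ℤP.+-identityʳ (F (suc (suc p) ∷ β)))))) ⟩
  ∑[ c ∈ comps (suc N) ] F (1 ∷ c) + ∑[ p < suc N ] ∑[ β ∈ comps (N ∸ p) ] F (suc (suc p) ∷ β) ∎
  where open ≡-Reasoning

count-comps : ∀ N γ → ∑[ c ∈ comps N ] δᶜ γ c ≡ [ allPositive γ ] * δ (size γ) N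
count-comps zero    []          = refl
count-comps zero    (zero  ∷ γ) = refl
count-comps zero    (suc x ∷ γ) = sym (ℤP.*-zeroʳ [ allPositive γ ])
count-comps (suc N) [] =
  trans (∑-comps-suc N (δᶜ [])) (trans (∑<-cong (suc N) (λ p → ∑-0 (comps (N ∸ p)))) (∑<-0 (suc N)))
count-comps (suc N) (zero ∷ γ) =
  trans (∑-comps-suc N (δᶜ (zero ∷ γ)))
        (trans (∑<-cong (suc N) (λ p → trans (∑-cong (comps (N ∸ p)) (λ β → δᶜ-∷ zero γ (suc p) β)) (∑-0 (comps (N ∸ p)))))
               (∑<-0 (suc N)))
count-comps (suc N) (suc x ∷ γ) = begin
  ∑ (comps (suc N)) (δᶜ (suc x ∷ γ))
    ≡⟨ ∑-comps-suc N (δᶜ (suc x ∷ γ)) ⟩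
  ∑[ p < suc N ] ∑[ β ∈ comps (N ∸ p) ] δᶜ (suc x ∷ γ) (suc p ∷ β)
    ≡⟨ ∑<-cong (suc N) (λ p → trans (∑-cong (comps (N ∸ p)) (λ β →
                                         trans (δᶜ-∷ (suc x) γ (suc p) β) (cong (_* δᶜ γ β) (δ-suc x p))))
                                (trans (∑-*ˡ (comps (N ∸ p)) (δ x p) (δᶜ γ)) (cong (δ x p *_) (count-comps (N ∸ p) γ)))) ⟩
  ∑[ p < suc N ] (δ x p * ([ allPositive γ ] * δ (size γ) (N ∸ p)))
    ≡⟨ ∑<-δ N x (λ p → [ allPositive γ ] * δ (size γ) (N ∸ p)) ⟩
  [ x ℕ.≤ᵇ N ] * ([ allPositive γ ] * δ (size γ) (N ∸ x))
    ≡⟨ swap [ x ℕ.≤ᵇ N ] [ allPositive γ ] (δ (size γ) (N ∸ x)) ⟩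
  [ allPositive γ ] * ([ x ℕ.≤ᵇ N ] * δ (size γ) (N ∸ x))
    ≡⟨ cong ([ allPositive γ ] *_) (trans (δ-∸ x N (size γ)) (sym (δ-suc (x ℕ.+ size γ) N))) ⟩
  [ allPositive γ ] * δ (suc (x ℕ.+ size γ)) (suc N) ∎
  where
  open ≡-Reasoning
  swap : ∀ a b c → a * (b * c) ≡ b * (a * c)
  swap = solve-∀

count-as-∑ : ∀ α L → + count α L ≡ ∑[ c ∈ L ] δᶜ α c
count-as-∑ α []      = refl
count-as-∑ α (c ∷ L) with LP.≡-dec ℕ._≟_ α c
... | yes _ = cong (_+_ 1ℤ) (count-as-∑ α L)
... | no  _ = trans (count-as-∑ α L) (sym (ℤP.+-identityˡ _))

count-compsUpTo : ∀ N γ → ∑[ c ∈ compsUpTo N ] δᶜ γ c ≡ [ allPositive γ ] * [ size γ ℕ.≤ᵇ N ]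
count-compsUpTo N γ = begin
  ∑[ c ∈ compsUpTo N ] δᶜ γ c
    ≡⟨ trans (∑-concatMap comps (upTo (suc N)) (δᶜ γ)) (∑-upTo (suc N) (λ n → ∑[ c ∈ comps n ] δᶜ γ c)) ⟩
  ∑[ n < suc N ] ∑[ c ∈ comps n ] δᶜ γ c
    ≡⟨ ∑<-cong (suc N) (λ n → trans (count-comps n γ) (cong ([ allPositive γ ] *_) (sym (ℤP.*-identityʳ _)))) ⟩
  ∑[ n < suc N ] ([ allPositive γ ] * (δ (size γ) n * 1ℤ))
    ≡⟨ ∑<-*ˡ (suc N) [ allPositive γ ] (λ n → δ (size γ) n * 1ℤ) ⟩
  [ allPositive γ ] * ∑[ n < suc N ] (δ (size γ) n * 1ℤ)
    ≡⟨ cong ([ allPositive γ ] *_) (trans (∑<-δ N (size γ) (λ _ → 1ℤ)) (ℤP.*-identityʳ _)) ⟩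
  [ allPositive γ ] * [ size γ ℕ.≤ᵇ N ] ∎
  where open ≡-Reasoning

sgn-+ : ∀ x y → sgn (x ℕ.+ y) ≡ sgn x * sgn y
sgn-+ zero    y = sym (ℤP.*-identityˡ (sgn y))
sgn-+ (suc x) y = trans (cong -_ (sgn-+ x y)) (ℤP.neg-distribˡ-* (sgn x) (sgn y))

-- sign α = (-1)^(|α| - ℓ(α)) is the coefficient of H_α in Λ_{|α|}.
sign : Composition → ℤ
sign []      = 1ℤ
sign (x ∷ α) = sgn (suc x) * sign α

sign-ones : ∀ j → sign (replicate j 1) ≡ 1ℤ
sign-ones zero    = refl
sign-ones (suc j) = trans (ℤP.*-identityˡ _) (sign-ones j)

∑-qsh-sign : ∀ a b → ∑ (qsh a b) sign ≡ sign a * sign b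
∑-qsh-sign []      b       = trans (ℤP.+-identityʳ (sign b)) (sym (ℤP.*-identityˡ (sign b)))
∑-qsh-sign (x ∷ a) []      = trans (ℤP.+-identityʳ (sign (x ∷ a))) (sym (ℤP.*-identityʳ (sign (x ∷ a))))
∑-qsh-sign (x ∷ a) (y ∷ b) = begin
  ∑ (L₁ ++ L₂ ++ L₃) sign
    ≡⟨ trans (∑-++ L₁ (L₂ ++ L₃) sign) (cong (_+_ (∑ L₁ sign)) (∑-++ L₂ L₃ sign)) ⟩
  ∑ L₁ sign + (∑ L₂ sign + ∑ L₃ sign)
    ≡⟨ cong₂ _+_ (prepend x (qsh a (y ∷ b))) (cong₂ _+_ (prepend y (qsh (x ∷ a) b)) (prepend (x ℕ.+ y) (qsh a b))) ⟩
  X * ∑ (qsh a (y ∷ b)) sign + (Y * ∑ (qsh (x ∷ a) b) sign + sgn (suc (x ℕ.+ y)) * ∑ (qsh a b) sign)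
    ≡⟨ cong₂ (λ u v → X * u + (Y * v + sgn (suc (x ℕ.+ y)) * ∑ (qsh a b) sign)) (∑-qsh-sign a (y ∷ b)) (∑-qsh-sign (x ∷ a) b) ⟩
  X * (sign a * (Y * sign b)) + (Y * ((X * sign a) * sign b) + sgn (suc (x ℕ.+ y)) * ∑ (qsh a b) sign)
    ≡⟨ cong₂ (λ u v → X * (sign a * (Y * sign b)) + (Y * ((X * sign a) * sign b) + u * v)) (sgn-suc-+ x y) (∑-qsh-sign a b) ⟩
  X * (sign a * (Y * sign b)) + (Y * ((X * sign a) * sign b) + - (X * Y) * (sign a * sign b))
    ≡⟨ collect X Y (sign a) (sign b) ⟩
  (X * sign a) * (Y * sign b) ∎
  where
  open ≡-Reasoning
  X Y : ℤ
  X = sgn (suc x)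
  Y = sgn (suc y)
  L₁ L₂ L₃ : List Composition
  L₁ = map (x ∷_) (qsh a (y ∷ b))
  L₂ = map (y ∷_) (qsh (x ∷ a) b)
  L₃ = map (x ℕ.+ y ∷_) (qsh a b)
  prepend : ∀ z cs → ∑ (map (z ∷_) cs) sign ≡ sgn (suc z) * ∑ cs sign
  prepend z cs = trans (∑-map (z ∷_) cs sign) (∑-*ˡ cs (sgn (suc z)) sign)
  sgn-suc-+ : ∀ x y → sgn (suc (x ℕ.+ y)) ≡ - (sgn (suc x) * sgn (suc y))
  sgn-suc-+ x y = cong -_ (trans (sgn-+ x y) (negate-both (sgn x) (sgn y)))
    where
    negate-both : ∀ a b → a * b ≡ - a * - b
    negate-both = solve-∀
  collect : ∀ X Y a b → X * (a * (Y * b)) + (Y * ((X * a) * b) + - (X * Y) * (a * b)) ≡ (X * a) * (Y * b)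
  collect = solve-∀

qsh-sound : ∀ a b → allPositive a ≡ true → allPositive b ≡ true →
            All (IsCompositionOf (size a ℕ.+ size b)) (qsh a b)
qsh-sound []      b       _ pos-b = (pos-b , refl) ∷ []
qsh-sound (x ∷ a) []      pos-a _ = (pos-a , sym (ℕP.+-identityʳ _)) ∷ []
qsh-sound (zero  ∷ a) (y ∷ b)     () _
qsh-sound (suc x ∷ a) (zero ∷ b)  _ ()
qsh-sound (suc x ∷ a) (suc y ∷ b) pos-a pos-b =
  AllP.++⁺ (prepend x (sym (ℕP.+-assoc (suc x) (size a) _)) (qsh-sound a (suc y ∷ b) pos-a pos-b))
  (AllP.++⁺ (prepend y (exchange (suc y) (suc x) (size a) (size b)) (qsh-sound (suc x ∷ a) b pos-a pos-b))
            (prepend (x ℕ.+ suc y) (interchange (suc x) (suc y) (size a) (size b)) (qsh-sound a b pos-a pos-b)))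
  where
  N : ℕ
  N = size (suc x ∷ a) ℕ.+ size (suc y ∷ b)
  prepend : ∀ z {m cs} → suc z ℕ.+ m ≡ N → All (IsCompositionOf m) cs → All (IsCompositionOf N) (map (suc z ∷_) cs)
  prepend z eq = AllP.map⁺ ∘ All.map (λ (pos , sz) → pos , trans (cong (suc z ℕ.+_) sz) eq)
  exchange : ∀ y x a b → y ℕ.+ ((x ℕ.+ a) ℕ.+ b) ≡ (x ℕ.+ a) ℕ.+ (y ℕ.+ b)
  exchange = ℕS.solve-∀
  interchange : ∀ x y a b → (x ℕ.+ y) ℕ.+ (a ℕ.+ b) ≡ (x ℕ.+ a) ℕ.+ (y ℕ.+ b)
  interchange = ℕS.solve-∀

-- The compositions 1 ∷ c and bump c cancel in pairs; this is why F_i^⊥ kills Λ_m for i ≥ 2.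
∑-comps-sign : ∀ n → ∑ (comps (suc (suc n))) sign ≡ 0ℤ
∑-comps-sign n =
  trans (∑-concatMap (λ c → (1 ∷ c) ∷ bump c) (comps (suc n)) sign)
        (trans (∑-congᴬ (comps-sound (suc n)) cancel) (∑-0 (comps (suc n))))
  where
  cancel : ∀ c → IsCompositionOf (suc n) c → ∑ ((1 ∷ c) ∷ bump c) sign ≡ 0ℤ
  cancel []          (_ , ())
  cancel (zero ∷ c)  (() , _)
  cancel (suc x ∷ c) _ = opposite (sgn (suc (suc x))) (sign c)
    where
    opposite : ∀ a b → 1ℤ * (a * b) + (- a * b + 0ℤ) ≡ 0ℤ
    opposite = solve-∀

∑-δᶜ : (xs : List Composition) (a : ℤ) (γ : Composition) (F : Composition → ℤ) →
       ∑[ α ∈ xs ] (a * (δᶜ γ α * F α)) ≡ a * (F γ * ∑ xs (δᶜ γ))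
∑-δᶜ xs a γ F = begin
  ∑[ α ∈ xs ] (a * (δᶜ γ α * F α)) ≡⟨ ∑-cong xs (λ α → trans (cong (a *_) (δᶜ-subst γ α F)) (reorder a (δᶜ γ α) (F γ))) ⟩
  ∑[ α ∈ xs ] (a * (F γ * δᶜ γ α)) ≡⟨ trans (∑-*ˡ xs a _) (cong (a *_) (∑-*ˡ xs (F γ) (δᶜ γ))) ⟩
  a * (F γ * ∑ xs (δᶜ γ))         ∎
  where
  open ≡-Reasoning
  reorder : ∀ a d b → a * (d * b) ≡ a * (b * d)
  reorder = solve-∀

Λ : ℕ → NSym
Λ m = map (λ α → term (sign α) 0 α) (comps m)

-- Coefficients of F_{1^j}^⊥ Λ_m = Λ_{m - j} (which is 0 when j > m).
Λ-skew : ℕ → ℕ → Coeffs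
Λ-skew j m k γ = δ k 0 * (sign γ * ([ allPositive γ ] * δ (j ℕ.+ size γ) m))

⟦Λ⟧ : ∀ m k γ → ⟦ Λ m ⟧ k γ ≡ Λ-skew 0 m k γ
⟦Λ⟧ m k γ = trans (⟦map-term⟧ sign (λ _ → 0) (λ α → α) (comps m) k γ)
                  (trans (∑-δᶜ (comps m) (δ k 0) γ sign) (cong (λ z → δ k 0 * (sign γ * z)) (count-comps m γ)))

⟦ext-Λ⟧ : ∀ φ m k β → ⟦ ext φ (Λ m) ⟧ k β ≡ ∑[ α ∈ comps m ] (sign α * ⟦ φ α ⟧ k β)
⟦ext-Λ⟧ φ m k β = trans (⟦ext⟧ φ (Λ m) k β) (∑-map (λ α → term (sign α) 0 α) (comps m) _)

-- The action of F^⊥ on Λ_m, for F = ∑_{d ∈ S} M_d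

sum-as-∑ : {A : Set} (f : A → ℕ) (xs : List A) → + sum (map f xs) ≡ ∑[ x ∈ xs ] (+ f x)
sum-as-∑ f []       = refl
sum-as-∑ f (x ∷ xs) = cong (_+_ (+ f x)) (sum-as-∑ f xs)

pairFM-as-∑ : ∀ S α γ → + pairFM S α γ ≡ ∑[ d ∈ S ] ∑[ c ∈ qsh d γ ] δᶜ α c
pairFM-as-∑ S α γ = trans (sum-as-∑ (λ d → count α (qsh d γ)) S) (∑-cong S (λ d → count-as-∑ α (qsh d γ)))

⟦perpB⟧ : ∀ S α k γ → ⟦ perpB S α ⟧ k γ ≡ δ k 0 * ([ allPositive γ ] * ([ size γ ℕ.≤ᵇ size α ] * + pairFM S α γ))
⟦perpB⟧ S α k γ = begin
  ⟦ perpB S α ⟧ k γ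
    ≡⟨ ⟦map-term⟧ (λ γ′ → + pairFM S α γ′) (λ _ → 0) (λ γ′ → γ′) (compsUpTo (size α)) k γ ⟩
  ∑[ γ′ ∈ compsUpTo (size α) ] (δ k 0 * (δᶜ γ γ′ * + pairFM S α γ′))
    ≡⟨ ∑-δᶜ (compsUpTo (size α)) (δ k 0) γ (λ γ′ → + pairFM S α γ′) ⟩
  δ k 0 * (+ pairFM S α γ * ∑[ γ′ ∈ compsUpTo (size α) ] δᶜ γ γ′)
    ≡⟨ cong (λ z → δ k 0 * (+ pairFM S α γ * z)) (count-compsUpTo (size α) γ) ⟩
  δ k 0 * (+ pairFM S α γ * ([ allPositive γ ] * [ size γ ℕ.≤ᵇ size α ]))
    ≡⟨ cong (δ k 0 *_) (reorder (+ pairFM S α γ) [ allPositive γ ] [ size γ ℕ.≤ᵇ size α ]) ⟩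
  δ k 0 * ([ allPositive γ ] * ([ size γ ℕ.≤ᵇ size α ] * + pairFM S α γ)) ∎
  where
  open ≡-Reasoning
  reorder : ∀ p a b → p * (a * b) ≡ a * (b * p)
  reorder = solve-∀

∑-comps-sign-δᶜ : ∀ m c → ∑[ α ∈ comps m ] (sign α * δᶜ α c) ≡ sign c * ([ allPositive c ] * δ (size c) m)
∑-comps-sign-δᶜ m c = begin
  ∑[ α ∈ comps m ] (sign α * δᶜ α c) ≡⟨ ∑-cong (comps m) (λ α →
                                          trans (ℤP.*-comm (sign α) _) (trans (cong (_* sign α) (δᶜ-sym α c)) (δᶜ-subst′ α))) ⟩
  ∑[ α ∈ comps m ] (sign c * δᶜ c α) ≡⟨ ∑-*ˡ (comps m) (sign c) (δᶜ c) ⟩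
  sign c * ∑[ α ∈ comps m ] δᶜ c α   ≡⟨ cong (sign c *_) (count-comps m c) ⟩
  sign c * ([ allPositive c ] * δ (size c) m) ∎
  where
  open ≡-Reasoning
  δᶜ-subst′ : ∀ α → δᶜ c α * sign α ≡ sign c * δᶜ c α
  δᶜ-subst′ α = trans (δᶜ-subst c α sign) (ℤP.*-comm (δᶜ c α) (sign c))

∑-comps-sign-pairFM : ∀ S m γ → ∑[ α ∈ comps m ] (sign α * + pairFM S α γ)
                              ≡ ∑[ d ∈ S ] ∑[ c ∈ qsh d γ ] (sign c * ([ allPositive c ] * δ (size c) m))
∑-comps-sign-pairFM S m γ = begin
  ∑[ α ∈ comps m ] (sign α * + pairFM S α γ)
    ≡⟨ ∑-cong (comps m) (λ α → trans (cong (sign α *_) (pairFM-as-∑ S α γ))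
         (trans (sym (∑-*ˡ S (sign α) _)) (∑-cong S (λ d → sym (∑-*ˡ (qsh d γ) (sign α) (δᶜ α)))))) ⟩
  ∑[ α ∈ comps m ] ∑[ d ∈ S ] ∑[ c ∈ qsh d γ ] (sign α * δᶜ α c)
    ≡⟨ ∑-comm (comps m) S _ ⟩
  ∑[ d ∈ S ] ∑[ α ∈ comps m ] ∑[ c ∈ qsh d γ ] (sign α * δᶜ α c)
    ≡⟨ ∑-cong S (λ d → trans (∑-comm (comps m) (qsh d γ) _) (∑-cong (qsh d γ) (∑-comps-sign-δᶜ m))) ⟩
  ∑[ d ∈ S ] ∑[ c ∈ qsh d γ ] (sign c * ([ allPositive c ] * δ (size c) m)) ∎
  where open ≡-Reasoning

∑-qsh-Λ : ∀ d γ m → allPositive d ≡ true → allPositive γ ≡ true →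
          ∑[ c ∈ qsh d γ ] (sign c * ([ allPositive c ] * δ (size c) m)) ≡ sign d * (sign γ * δ (size d ℕ.+ size γ) m)
∑-qsh-Λ d γ m pos-d pos-γ = begin
  ∑[ c ∈ qsh d γ ] (sign c * ([ allPositive c ] * δ (size c) m))
    ≡⟨ ∑-congᴬ (qsh-sound d γ pos-d pos-γ) (λ c (pos-c , |c|) →
         trans (cong₂ (λ b n → sign c * ([ b ] * δ n m)) pos-c |c|) (trans (cong (sign c *_) (ℤP.*-identityˡ _)) (ℤP.*-comm (sign c) _))) ⟩
  ∑[ c ∈ qsh d γ ] (D * sign c)
    ≡⟨ trans (∑-*ˡ (qsh d γ) D sign) (cong (D *_) (∑-qsh-sign d γ)) ⟩
  D * (sign d * sign γ)
    ≡⟨ trans (ℤP.*-comm D _) (ℤP.*-assoc (sign d) (sign γ) D) ⟩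
  sign d * (sign γ * D) ∎
  where
  open ≡-Reasoning
  D : ℤ
  D = δ (size d ℕ.+ size γ) m

[]-guard : ∀ b {X Y} → (b ≡ true → X ≡ Y) → [ b ] * X ≡ [ b ] * Y
[]-guard true  X≡Y = cong (1ℤ *_) (X≡Y refl)
[]-guard false X≡Y = refl

-- F^⊥ Λ_m = ∑_γ ⟨Λ_m, F M_γ⟩ H_γ, and ⟨Λ_m, M_c⟩ = sign c · [c ⊨ m] is multiplicative along quasi-shuffles.
⟦perp-Λ⟧ : ∀ S m k γ → All (λ d → allPositive d ≡ true) S →
           ⟦ perp S (Λ m) ⟧ k γ
           ≡ δ k 0 * ([ allPositive γ ] * ([ size γ ℕ.≤ᵇ m ] * ∑[ d ∈ S ] (sign d * (sign γ * δ (size d ℕ.+ size γ) m))))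
⟦perp-Λ⟧ S m k γ S-pos = begin
  ⟦ perp S (Λ m) ⟧ k γ
    ≡⟨ ⟦ext-Λ⟧ (perpB S) m k γ ⟩
  ∑[ α ∈ comps m ] (sign α * ⟦ perpB S α ⟧ k γ)
    ≡⟨ ∑-congᴬ (comps-sound m) (λ α (_ , |α|≡m) → trans (cong (sign α *_) (⟦perpB⟧ S α k γ))
          (trans (cong (λ n → sign α * (δ k 0 * ([ allPositive γ ] * ([ size γ ℕ.≤ᵇ n ] * + pairFM S α γ)))) |α|≡m)
                 (reorder (sign α) (δ k 0) [ allPositive γ ] [ size γ ℕ.≤ᵇ m ] (+ pairFM S α γ)))) ⟩
  ∑[ α ∈ comps m ] (κ * (sign α * + pairFM S α γ))
    ≡⟨ ∑-*ˡ (comps m) κ _ ⟩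
  κ * ∑[ α ∈ comps m ] (sign α * + pairFM S α γ)
    ≡⟨ cong (κ *_) (∑-comps-sign-pairFM S m γ) ⟩
  κ * ∑[ d ∈ S ] ∑[ c ∈ qsh d γ ] (sign c * ([ allPositive c ] * δ (size c) m))
    ≡⟨ reassoc (δ k 0) [ allPositive γ ] [ size γ ℕ.≤ᵇ m ] _ ⟩
  δ k 0 * ([ allPositive γ ] * ([ size γ ℕ.≤ᵇ m ] * ∑[ d ∈ S ] ∑[ c ∈ qsh d γ ] (sign c * ([ allPositive c ] * δ (size c) m))))
    ≡⟨ cong (δ k 0 *_) ([]-guard (allPositive γ) (λ pos-γ → cong ([ size γ ℕ.≤ᵇ m ] *_)
         (∑-congᴬ S-pos (λ d pos-d → ∑-qsh-Λ d γ m pos-d pos-γ)))) ⟩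
  δ k 0 * ([ allPositive γ ] * ([ size γ ℕ.≤ᵇ m ] * ∑[ d ∈ S ] (sign d * (sign γ * δ (size d ℕ.+ size γ) m)))) ∎
  where
  open ≡-Reasoning
  reassoc : ∀ d a l x → (d * (a * l)) * x ≡ d * (a * (l * x))
  reassoc = solve-∀
  κ : ℤ
  κ = δ k 0 * ([ allPositive γ ] * [ size γ ℕ.≤ᵇ m ])
  reorder : ∀ s d a l p → s * (d * (a * (l * p))) ≡ (d * (a * l)) * (s * p)
  reorder = solve-∀

⟦perp-M-Λ⟧ : ∀ d m k γ → allPositive d ≡ true → sign d ≡ 1ℤ → ⟦ perp (d ∷ []) (Λ m) ⟧ k γ ≡ Λ-skew (size d) m k γ
⟦perp-M-Λ⟧ d m k γ pos-d sign-d = begin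
  ⟦ perp (d ∷ []) (Λ m) ⟧ k γ
    ≡⟨ ⟦perp-Λ⟧ (d ∷ []) m k γ (pos-d ∷ []) ⟩
  δ k 0 * ([ allPositive γ ] * ([ size γ ℕ.≤ᵇ m ] * (sign d * (sign γ * D) + 0ℤ)))
    ≡⟨ cong (λ s → δ k 0 * ([ allPositive γ ] * ([ size γ ℕ.≤ᵇ m ] * (s * (sign γ * D) + 0ℤ)))) sign-d ⟩
  δ k 0 * ([ allPositive γ ] * ([ size γ ℕ.≤ᵇ m ] * (1ℤ * (sign γ * D) + 0ℤ)))
    ≡⟨ reorder (δ k 0) [ allPositive γ ] [ size γ ℕ.≤ᵇ m ] (sign γ) D ⟩
  δ k 0 * (sign γ * ([ allPositive γ ] * ([ size γ ℕ.≤ᵇ m ] * D)))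
    ≡⟨ cong (λ z → δ k 0 * (sign γ * ([ allPositive γ ] * z))) (≤ᵇ-δ m (ℕP.m≤n+m (size γ) (size d))) ⟩
  Λ-skew (size d) m k γ ∎
  where
  open ≡-Reasoning
  D : ℤ
  D = δ (size d ℕ.+ size γ) m
  reorder : ∀ d a l s x → d * (a * (l * (1ℤ * (s * x) + 0ℤ))) ≡ d * (s * (a * (l * x)))
  reorder = solve-∀

⟦perp-F1-Λ⟧ : ∀ j m k γ → ⟦ perp (F1i j) (Λ m) ⟧ k γ ≡ Λ-skew j m k γ
⟦perp-F1-Λ⟧ j m k γ =
  trans (⟦perp-M-Λ⟧ (replicate j 1) m k γ (ones-positive j) (sign-ones j)) (cong (λ n → Λ-skew n m k γ) (size-ones j))
  where
  ones-positive : ∀ j → allPositive (replicate j 1) ≡ true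
  ones-positive zero    = refl
  ones-positive (suc j) = ones-positive j
  size-ones : ∀ j → size (replicate j 1) ≡ j
  size-ones zero    = refl
  size-ones (suc j) = cong suc (size-ones j)

perp-F0-Λ : ∀ m → perp (Fi 0) (Λ m) ≈ Λ m
perp-F0-Λ m k γ = trans (⟦perp-M-Λ⟧ [] m k γ refl refl) (sym (⟦Λ⟧ m k γ))

perp-F1-Λ : ∀ r → perp (Fi 1) (Λ (suc r)) ≈ Λ r
perp-F1-Λ r k γ = trans (⟦perp-M-Λ⟧ (1 ∷ []) (suc r) k γ refl refl)
  (trans (cong (λ z → δ k 0 * (sign γ * ([ allPositive γ ] * z))) (δ-suc (size γ) r)) (sym (⟦Λ⟧ r k γ)))

perp-F2-Λ : ∀ i m → perp (Fi (suc (suc i))) (Λ m) ≈ []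
perp-F2-Λ i m k γ = begin
  ⟦ perp (Fi (suc (suc i))) (Λ m) ⟧ k γ
    ≡⟨ ⟦perp-Λ⟧ (comps (suc (suc i))) m k γ (All.map proj₁ (comps-sound (suc (suc i)))) ⟩
  δ k 0 * ([ allPositive γ ] * ([ size γ ℕ.≤ᵇ m ] * ∑[ d ∈ comps (suc (suc i)) ] (sign d * (sign γ * δ (size d ℕ.+ size γ) m))))
    ≡⟨ cong (λ z → δ k 0 * ([ allPositive γ ] * ([ size γ ℕ.≤ᵇ m ] * z))) vanish ⟩
  δ k 0 * ([ allPositive γ ] * ([ size γ ℕ.≤ᵇ m ] * 0ℤ))
    ≡⟨ zero-right (δ k 0) [ allPositive γ ] [ size γ ℕ.≤ᵇ m ] ⟩
  0ℤ ∎
  where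
  open ≡-Reasoning
  X : ℤ
  X = sign γ * δ (suc (suc i) ℕ.+ size γ) m
  vanish : ∑[ d ∈ comps (suc (suc i)) ] (sign d * (sign γ * δ (size d ℕ.+ size γ) m)) ≡ 0ℤ
  vanish = begin
    ∑[ d ∈ comps (suc (suc i)) ] (sign d * (sign γ * δ (size d ℕ.+ size γ) m))
      ≡⟨ ∑-congᴬ (comps-sound (suc (suc i))) (λ d (_ , |d|) →
           trans (cong (λ n → sign d * (sign γ * δ (n ℕ.+ size γ) m)) |d|) (ℤP.*-comm (sign d) X)) ⟩
    ∑[ d ∈ comps (suc (suc i)) ] (X * sign d)
      ≡⟨ trans (∑-*ˡ (comps (suc (suc i))) X sign) (cong (X *_) (∑-comps-sign i)) ⟩
    X * 0ℤ
      ≡⟨ ℤP.*-zeroʳ X ⟩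
    0ℤ ∎
  zero-right : ∀ d a l → d * (a * (l * 0ℤ)) ≡ 0ℤ
  zero-right = solve-∀

-- The operators 𝔹_m on Λ

H-prefix-∑ : ∀ a {A : Set} (xs : List A) (c : A → ℤ) (F : A → Coeffs) k β →
             ∑[ x ∈ xs ] (c x * H-prefix a (F x) k β) ≡ H-prefix a (λ k′ γ → ∑[ x ∈ xs ] (c x * F x k′ γ)) k β
H-prefix-∑ a xs c F k []      = trans (∑-cong xs (ℤP.*-zeroʳ ∘ c)) (∑-0 xs)
H-prefix-∑ a xs c F k (y ∷ β) =
  trans (∑-cong xs (λ x → swap (c x) (δ y (suc a)) (F x k β))) (∑-*ˡ xs (δ y (suc a)) (λ x → c x * F x k β))
  where
  swap : ∀ c d f → c * (d * f) ≡ d * (c * f)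
  swap = solve-∀

H-prefix-cong : ∀ a {F G : Coeffs} → (∀ k γ → F k γ ≡ G k γ) → ∀ k β → H-prefix a F k β ≡ H-prefix a G k β
H-prefix-cong a F≗G k []      = refl
H-prefix-cong a F≗G k (y ∷ β) = cong (δ y (suc a) *_) (F≗G k β)

⟦BB⟧ : ∀ a α k β → ⟦ BB (suc a) α ⟧ k β ≡ ∑[ i < suc (size α) ] (sgn i * H-prefix (a ℕ.+ i) ⟦ perpB (F1i i) α ⟧ k β)
⟦BB⟧ a α k β =
  trans (⟦concatMap⟧ summand (upTo (suc (size α))) k β)
  (trans (∑-upTo (suc (size α)) (λ i → ⟦ summand i ⟧ k β))
  (∑<-cong (suc (size α)) (λ i → trans (⟦scale-0⟧ (sgn i) (Hmul (suc (a ℕ.+ i)) (perpB (F1i i) α)) k β)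
     (cong (sgn i *_) (⟦Hmul⟧ (a ℕ.+ i) (perpB (F1i i) α) k β)))))
  where
  summand : ℕ → NSym
  summand i = scale (sgn i) 0 (Hmul (suc (a ℕ.+ i)) (perpB (F1i i) α))

⟦B-Λ⟧ : ∀ a m k β → ⟦ B (suc a) (Λ m) ⟧ k β ≡ ∑[ i < suc m ] (sgn i * H-prefix (a ℕ.+ i) (Λ-skew i m) k β)
⟦B-Λ⟧ a m k β = begin
  ⟦ B (suc a) (Λ m) ⟧ k β
    ≡⟨ ⟦ext-Λ⟧ (BB (suc a)) m k β ⟩
  ∑[ α ∈ comps m ] (sign α * ⟦ BB (suc a) α ⟧ k β)
    ≡⟨ ∑-congᴬ (comps-sound m) (λ α (_ , |α|≡m) → trans (cong (sign α *_) (⟦BB⟧ a α k β))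
         (trans (cong (λ n → sign α * ∑< (suc n) (P α)) |α|≡m) (sym (∑<-*ˡ (suc m) (sign α) (P α))))) ⟩
  ∑[ α ∈ comps m ] ∑[ i < suc m ] (sign α * P α i)
    ≡⟨ ∑-∑<-comm (comps m) (suc m) (λ α i → sign α * P α i) ⟩
  ∑[ i < suc m ] ∑[ α ∈ comps m ] (sign α * P α i)
    ≡⟨ ∑<-cong (suc m) (λ i → begin
         ∑[ α ∈ comps m ] (sign α * P α i)
           ≡⟨ trans (∑-cong (comps m) (λ α → swap (sign α) (sgn i) _)) (∑-*ˡ (comps m) (sgn i) _) ⟩
         sgn i * ∑[ α ∈ comps m ] (sign α * H-prefix (a ℕ.+ i) ⟦ perpB (F1i i) α ⟧ k β)
           ≡⟨ cong (sgn i *_) (H-prefix-∑ (a ℕ.+ i) (comps m) sign (λ α → ⟦ perpB (F1i i) α ⟧) k β) ⟩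
         sgn i * H-prefix (a ℕ.+ i) (λ k′ γ → ∑[ α ∈ comps m ] (sign α * ⟦ perpB (F1i i) α ⟧ k′ γ)) k β
           ≡⟨ cong (sgn i *_) (H-prefix-cong (a ℕ.+ i) (λ k′ γ →
                trans (sym (⟦ext-Λ⟧ (perpB (F1i i)) m k′ γ)) (⟦perp-F1-Λ⟧ i m k′ γ)) k β) ⟩
         sgn i * H-prefix (a ℕ.+ i) (Λ-skew i m) k β ∎) ⟩
  ∑[ i < suc m ] (sgn i * H-prefix (a ℕ.+ i) (Λ-skew i m) k β) ∎
  where
  open ≡-Reasoning
  P : Composition → ℕ → ℤ
  P α i = sgn i * H-prefix (a ℕ.+ i) ⟦ perpB (F1i i) α ⟧ k β
  swap : ∀ x s h → x * (s * h) ≡ s * (x * h)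
  swap = solve-∀

B1-Λ : ∀ m → B 1 (Λ m) ≈ Λ (suc m)
B1-Λ m k [] = begin
  ⟦ B 1 (Λ m) ⟧ k []                  ≡⟨ ⟦B-Λ⟧ 0 m k [] ⟩
  ∑[ i < suc m ] (sgn i * 0ℤ)         ≡⟨ trans (∑<-cong (suc m) (ℤP.*-zeroʳ ∘ sgn)) (∑<-0 (suc m)) ⟩
  0ℤ                                  ≡⟨ sym (ℤP.*-zeroʳ (δ k 0)) ⟩
  δ k 0 * (1ℤ * (1ℤ * δ 0 (suc m)))   ≡⟨ sym (⟦Λ⟧ (suc m) k []) ⟩
  ⟦ Λ (suc m) ⟧ k []                  ∎
  where open ≡-Reasoning
B1-Λ m k (zero ∷ β) = begin
  ⟦ B 1 (Λ m) ⟧ k (zero ∷ β)                        ≡⟨ ⟦B-Λ⟧ 0 m k (zero ∷ β) ⟩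
  ∑[ i < suc m ] (sgn i * (0ℤ * Λ-skew i m k β))    ≡⟨ trans (∑<-cong (suc m) (ℤP.*-zeroʳ ∘ sgn)) (∑<-0 (suc m)) ⟩
  0ℤ                                                ≡⟨ sym (trans (cong (δ k 0 *_) (ℤP.*-zeroʳ (sign (zero ∷ β)))) (ℤP.*-zeroʳ (δ k 0))) ⟩
  δ k 0 * (sign (zero ∷ β) * 0ℤ)                    ≡⟨ sym (⟦Λ⟧ (suc m) k (zero ∷ β)) ⟩
  ⟦ Λ (suc m) ⟧ k (zero ∷ β)                        ∎
  where open ≡-Reasoning
B1-Λ m k (suc x ∷ β) = begin
  ⟦ B 1 (Λ m) ⟧ k (suc x ∷ β)
    ≡⟨ ⟦B-Λ⟧ 0 m k (suc x ∷ β) ⟩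
  ∑[ i < suc m ] (sgn i * (δ (suc x) (suc i) * Λ-skew i m k β))
    ≡⟨ ∑<-cong (suc m) (λ i → trans (cong (λ z → sgn i * (z * Λ-skew i m k β)) (δ-suc x i)) (swap (sgn i) (δ x i) _)) ⟩
  ∑[ i < suc m ] (δ x i * (sgn i * Λ-skew i m k β))
    ≡⟨ ∑<-δ m x (λ i → sgn i * Λ-skew i m k β) ⟩
  [ x ℕ.≤ᵇ m ] * (sgn x * (δ k 0 * (sign β * ([ allPositive β ] * δ (x ℕ.+ size β) m))))
    ≡⟨ reorder [ x ℕ.≤ᵇ m ] (sgn x) (δ k 0) (sign β) [ allPositive β ] (δ (x ℕ.+ size β) m) ⟩
  δ k 0 * ((sgn x * sign β) * ([ allPositive β ] * ([ x ℕ.≤ᵇ m ] * δ (x ℕ.+ size β) m)))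
    ≡⟨ cong₂ (λ s d → δ k 0 * ((s * sign β) * ([ allPositive β ] * d)))
             (sym (ℤP.neg-involutive (sgn x))) (trans (≤ᵇ-δ m (ℕP.m≤m+n x (size β))) (sym (δ-suc (x ℕ.+ size β) m))) ⟩
  δ k 0 * (sign (suc x ∷ β) * ([ allPositive β ] * δ (suc (x ℕ.+ size β)) (suc m)))
    ≡⟨ sym (⟦Λ⟧ (suc m) k (suc x ∷ β)) ⟩
  ⟦ Λ (suc m) ⟧ k (suc x ∷ β) ∎
  where
  open ≡-Reasoning
  swap : ∀ s d f → s * (d * f) ≡ d * (s * f)
  swap = solve-∀
  reorder : ∀ l s d g a x → l * (s * (d * (g * (a * x)))) ≡ d * ((s * g) * (a * (l * x)))
  reorder = solve-∀

B-cong : ∀ c f g → f ≈ g → B c f ≈ B c g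
B-cong c = ext-cong (BB c)

𝔖-ones : ∀ m → 𝔖 (replicate m 1) ≈ Λ m
𝔖-ones zero    k β = refl
𝔖-ones (suc m) = begin
  B 1 (𝔖 (replicate m 1)) ≈⟨ B-cong 1 (𝔖 (replicate m 1)) (Λ m) (𝔖-ones m) ⟩
  B 1 (Λ m)               ≈⟨ B1-Λ m ⟩
  Λ (suc m)               ∎
  where open SetoidReasoning ≈-setoid

-- The operators 𝔹̃_m on Λ

⟦ext-ext-Λ⟧ : ∀ φ ψ r k β → ⟦ ext φ (ext ψ (Λ r)) ⟧ k β ≡ ∑[ α ∈ comps r ] (sign α * ⟦ ext φ (ψ α) ⟧ k β)
⟦ext-ext-Λ⟧ φ ψ r k β =
  trans (⟦ext-concatMap⟧ φ (λ t → scale (coeff t) (qdeg t) (ψ (word t))) (Λ r) k β)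
  (trans (∑-map (λ α → term (sign α) 0 α) (comps r) _)
  (∑-cong (comps r) (λ α → ⟦ext-scale⟧ φ (sign α) 0 (ψ α) k β)))

⟦BtB⟧ : ∀ c α k β → ⟦ BtB c α ⟧ k β ≡ ∑[ i < suc (size α) ] shift i ⟦ B (c ℕ.+ i) (perpB (Fi i) α) ⟧ k β
⟦BtB⟧ c α k β =
  trans (⟦concatMap⟧ summand (upTo (suc (size α))) k β)
  (trans (∑-upTo (suc (size α)) (λ i → ⟦ summand i ⟧ k β))
  (∑<-cong (suc (size α)) (λ i → trans (⟦scale⟧ 1ℤ i (B (c ℕ.+ i) (perpB (Fi i) α)) k β) (ℤP.*-identityˡ _))))
  where
  summand : ℕ → NSym
  summand i = scale 1ℤ i (B (c ℕ.+ i) (perpB (Fi i) α))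

⟦Bt-Λ⟧ : ∀ c r k β → ⟦ Bt c (Λ r) ⟧ k β ≡ ∑[ i < suc r ] shift i ⟦ B (c ℕ.+ i) (perp (Fi i) (Λ r)) ⟧ k β
⟦Bt-Λ⟧ c r k β = begin
  ⟦ Bt c (Λ r) ⟧ k β
    ≡⟨ ⟦ext-Λ⟧ (BtB c) r k β ⟩
  ∑[ α ∈ comps r ] (sign α * ⟦ BtB c α ⟧ k β)
    ≡⟨ ∑-congᴬ (comps-sound r) (λ α (_ , |α|≡r) → trans (cong (sign α *_) (⟦BtB⟧ c α k β))
         (trans (cong (λ n → sign α * ∑< (suc n) (P α)) |α|≡r) (sym (∑<-*ˡ (suc r) (sign α) (P α))))) ⟩
  ∑[ α ∈ comps r ] ∑[ i < suc r ] (sign α * P α i)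
    ≡⟨ ∑-∑<-comm (comps r) (suc r) (λ α i → sign α * P α i) ⟩
  ∑[ i < suc r ] ∑[ α ∈ comps r ] (sign α * P α i)
    ≡⟨ ∑<-cong (suc r) (λ i → trans (sym (shift-∑ i (comps r) sign (λ α → ⟦ B (c ℕ.+ i) (perpB (Fi i) α) ⟧) k β))
         (shift-cong i (λ k′ β′ → sym (⟦ext-ext-Λ⟧ (BB (c ℕ.+ i)) (perpB (Fi i)) r k′ β′)) k β)) ⟩
  ∑[ i < suc r ] shift i ⟦ B (c ℕ.+ i) (perp (Fi i) (Λ r)) ⟧ k β ∎
  where
  open ≡-Reasoning
  P : Composition → ℕ → ℤ
  P α i = shift i ⟦ B (c ℕ.+ i) (perpB (Fi i) α) ⟧ k β

Bt-Λ-zero : ∀ c → Bt c (Λ 0) ≈ B c (Λ 0)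
Bt-Λ-zero c k β = begin
  ⟦ Bt c (Λ 0) ⟧ k β                             ≡⟨ trans (⟦Bt-Λ⟧ c 0 k β) (ℤP.+-identityʳ _) ⟩
  ⟦ B (c ℕ.+ 0) (perp (Fi 0) (Λ 0)) ⟧ k β         ≡⟨ B-cong (c ℕ.+ 0) (perp (Fi 0) (Λ 0)) (Λ 0) (perp-F0-Λ 0) k β ⟩
  ⟦ B (c ℕ.+ 0) (Λ 0) ⟧ k β                       ≡⟨ cong (λ n → ⟦ B n (Λ 0) ⟧ k β) (ℕP.+-identityʳ c) ⟩
  ⟦ B c (Λ 0) ⟧ k β                               ∎
  where open ≡-Reasoning

-- Only F_0^⊥ and F_1^⊥ act nontrivially on Λ_{r+1}.
⟦Bt-Λ-suc⟧ : ∀ c r k β → ⟦ Bt c (Λ (suc r)) ⟧ k β ≡ ⟦ B c (Λ (suc r)) ⟧ k β + shift 1 ⟦ B (suc c) (Λ r) ⟧ k β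
⟦Bt-Λ-suc⟧ c r k β = begin
  ⟦ Bt c (Λ (suc r)) ⟧ k β
    ≡⟨ ⟦Bt-Λ⟧ c (suc r) k β ⟩
  ⟦ B (c ℕ.+ 0) (perp (Fi 0) (Λ (suc r))) ⟧ k β
    + (shift 1 ⟦ B (c ℕ.+ 1) (perp (Fi 1) (Λ (suc r))) ⟧ k β
       + ∑[ i < r ] shift (suc (suc i)) ⟦ B (c ℕ.+ suc (suc i)) (perp (Fi (suc (suc i))) (Λ (suc r))) ⟧ k β)
    ≡⟨ cong₂ (λ x y → x + (shift 1 ⟦ B (c ℕ.+ 1) (perp (Fi 1) (Λ (suc r))) ⟧ k β + y)) F0-term F2-terms ⟩
  ⟦ B c (Λ (suc r)) ⟧ k β + (shift 1 ⟦ B (c ℕ.+ 1) (perp (Fi 1) (Λ (suc r))) ⟧ k β + 0ℤ)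
    ≡⟨ cong (_+_ (⟦ B c (Λ (suc r)) ⟧ k β)) (trans (ℤP.+-identityʳ _) (shift-cong 1 F1-term k β)) ⟩
  ⟦ B c (Λ (suc r)) ⟧ k β + shift 1 ⟦ B (suc c) (Λ r) ⟧ k β ∎
  where
  open ≡-Reasoning
  F0-term : ⟦ B (c ℕ.+ 0) (perp (Fi 0) (Λ (suc r))) ⟧ k β ≡ ⟦ B c (Λ (suc r)) ⟧ k β
  F0-term = trans (B-cong (c ℕ.+ 0) (perp (Fi 0) (Λ (suc r))) (Λ (suc r)) (perp-F0-Λ (suc r)) k β)
                  (cong (λ n → ⟦ B n (Λ (suc r)) ⟧ k β) (ℕP.+-identityʳ c))
  F1-term : ∀ k β → ⟦ B (c ℕ.+ 1) (perp (Fi 1) (Λ (suc r))) ⟧ k β ≡ ⟦ B (suc c) (Λ r) ⟧ k β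
  F1-term k β = trans (B-cong (c ℕ.+ 1) (perp (Fi 1) (Λ (suc r))) (Λ r) (perp-F1-Λ r) k β)
                      (cong (λ n → ⟦ B n (Λ r) ⟧ k β) (ℕP.+-comm c 1))
  F2-terms : ∑[ i < r ] shift (suc (suc i)) ⟦ B (c ℕ.+ suc (suc i)) (perp (Fi (suc (suc i))) (Λ (suc r))) ⟧ k β ≡ 0ℤ
  F2-terms = trans (∑<-cong r (λ i → trans (shift-cong (suc (suc i))
                     (B-cong (c ℕ.+ suc (suc i)) (perp (Fi (suc (suc i))) (Λ (suc r))) [] (perp-F2-Λ i (suc r))) k β)
                                          (shift-0 (suc (suc i)) k β)))
                   (∑<-0 r)

hookSum : ℕ → ℕ → (ℕ → NSym) → NSym
hookSum a m F = concatMap (λ j → negq j (Bt (suc a ℕ.+ j) (F (m ∸ j)))) (upTo (suc m))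

⟦hookSum⟧ : ∀ a m F k β → ⟦ hookSum a m F ⟧ k β ≡ ∑[ j < suc m ] (sgn j * shift j ⟦ Bt (suc a ℕ.+ j) (F (m ∸ j)) ⟧ k β)
⟦hookSum⟧ a m F k β =
  trans (⟦concatMap⟧ summand (upTo (suc m)) k β)
  (trans (∑-upTo (suc m) (λ j → ⟦ summand j ⟧ k β))
  (∑<-cong (suc m) (λ j → ⟦scale⟧ (sgn j) j (Bt (suc a ℕ.+ j) (F (m ∸ j))) k β)))
  where
  summand : ℕ → NSym
  summand j = negq j (Bt (suc a ℕ.+ j) (F (m ∸ j)))

hookSum-cong : ∀ a m F G → (∀ j → F (m ∸ j) ≈ G (m ∸ j)) → hookSum a m F ≈ hookSum a m G
hookSum-cong a m F G F≈G = concatMap-cong (summand F) (summand G) (upTo (suc m)) (λ j →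
  scale-cong (sgn j) j (Bt (suc a ℕ.+ j) (F (m ∸ j))) (Bt (suc a ℕ.+ j) (G (m ∸ j)))
    (ext-cong (BtB (suc a ℕ.+ j)) (F (m ∸ j)) (G (m ∸ j)) (F≈G j)))
  where
  summand : (ℕ → NSym) → ℕ → NSym
  summand H j = negq j (Bt (suc a ℕ.+ j) (H (m ∸ j)))

-- By ⟦Bt-Λ-suc⟧ the j-th term of hookSum a m Λ is T j - T (j+1), so the sum telescopes to T 0.
B-Λ-expansion : ∀ a m → B (suc a) (Λ m) ≈ hookSum a m Λ
B-Λ-expansion a m k β = sym (begin
  ⟦ hookSum a m Λ ⟧ k β     ≡⟨ ⟦hookSum⟧ a m Λ k β ⟩
  ∑[ j < suc m ] Ũ j (m ∸ j) ≡⟨ ∑<-telescope m (λ j → T j (m ∸ j)) (λ j → Ũ j (m ∸ j)) step last ⟩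
  T 0 m                      ≡⟨ trans (ℤP.*-identityˡ _) (cong (λ c → ⟦ B c (Λ m) ⟧ k β) (ℕP.+-identityʳ (suc a))) ⟩
  ⟦ B (suc a) (Λ m) ⟧ k β   ∎)
  where
  open ≡-Reasoning
  T Ũ : ℕ → ℕ → ℤ
  T j r = sgn j * shift j ⟦ B (suc a ℕ.+ j) (Λ r) ⟧ k β
  Ũ j r = sgn j * shift j ⟦ Bt (suc a ℕ.+ j) (Λ r) ⟧ k β
  step-suc : ∀ j n → Ũ j (suc n) ≡ T j (suc n) + - T (suc j) n
  step-suc j n = begin
    sgn j * shift j ⟦ Bt (suc a ℕ.+ j) (Λ (suc n)) ⟧ k β
      ≡⟨ cong (sgn j *_) (trans (shift-cong j (⟦Bt-Λ-suc⟧ (suc a ℕ.+ j) n) k β) (shift-+ j _ _ k β)) ⟩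
    sgn j * (shift j ⟦ B (suc a ℕ.+ j) (Λ (suc n)) ⟧ k β + shift j (shift 1 ⟦ B (suc (suc a ℕ.+ j)) (Λ n) ⟧) k β)
      ≡⟨ cong (λ x → sgn j * (shift j ⟦ B (suc a ℕ.+ j) (Λ (suc n)) ⟧ k β + x)) (sym (shift-shift j 1 _ k β)) ⟩
    sgn j * (shift j ⟦ B (suc a ℕ.+ j) (Λ (suc n)) ⟧ k β + shift (j ℕ.+ 1) ⟦ B (suc (suc a ℕ.+ j)) (Λ n) ⟧ k β)
      ≡⟨ cong₂ (λ e c → sgn j * (shift j ⟦ B (suc a ℕ.+ j) (Λ (suc n)) ⟧ k β + shift e ⟦ B c (Λ n) ⟧ k β))
               (ℕP.+-comm j 1) (sym (ℕP.+-suc (suc a) j)) ⟩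
    sgn j * (shift j ⟦ B (suc a ℕ.+ j) (Λ (suc n)) ⟧ k β + shift (suc j) ⟦ B (suc a ℕ.+ suc j) (Λ n) ⟧ k β)
      ≡⟨ distrib (sgn j) _ _ ⟩
    T j (suc n) + - T (suc j) n ∎
    where
    distrib : ∀ s x y → s * (x + y) ≡ s * x + - (- s * y)
    distrib = solve-∀
  step : ∀ j → j < m → Ũ j (m ∸ j) ≡ T j (m ∸ j) + - T (suc j) (m ∸ suc j)
  step j j<m = subst (λ r → Ũ j r ≡ T j r + - T (suc j) (m ∸ suc j)) (sym (ℕP.+-∸-assoc 1 j<m)) (step-suc j (m ∸ suc j))
  last : Ũ m (m ∸ m) ≡ T m (m ∸ m)
  last = subst (λ r → Ũ m r ≡ T m r) (sym (ℕP.n∸n≡0 m))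
               (cong (sgn m *_) (shift-cong m (Bt-Λ-zero (suc a ℕ.+ m)) k β))

-- Regrouping the right-hand sides by the first part of α

⟦if⟧ : ∀ b f k β → ⟦ if b then f else [] ⟧ k β ≡ [ b ] * ⟦ f ⟧ k β
⟦if⟧ true  f k β = sym (ℤP.*-identityˡ (⟦ f ⟧ k β))
⟦if⟧ false f k β = refl

length≤size : ∀ γ → allPositive γ ≡ true → length γ ≤ size γ
length≤size []          _   = z≤n
length≤size (zero ∷ γ)  ()
length≤size (suc x ∷ γ) pos = s≤s (ℕP.≤-trans (length≤size γ pos) (ℕP.m≤n+m (size γ) x))

⟦rhsHook⟧ : ∀ a m k β → ⟦ rhsHook (suc a ℕ.+ m) (suc a) ⟧ k β
            ≡ ∑[ j < suc m ] ∑[ γ ∈ comps (m ∸ j) ] ⟦ negq (m ∸ length γ) (Bt (suc a ℕ.+ j) (Q′ γ)) ⟧ k β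
⟦rhsHook⟧ a m k β = begin
  ⟦ rhsHook (suc a ℕ.+ m) (suc a) ⟧ k β
    ≡⟨ trans (⟦concatMap⟧ h (comps (suc (a ℕ.+ m))) k β) (∑-comps-suc (a ℕ.+ m) (λ α → ⟦ h α ⟧ k β)) ⟩
  ∑[ p < suc (a ℕ.+ m) ] ∑[ γ ∈ comps ((a ℕ.+ m) ∸ p) ] ⟦ h (suc p ∷ γ) ⟧ k β
    ≡⟨ ∑<-cong (suc (a ℕ.+ m)) (λ p → ∑-cong (comps ((a ℕ.+ m) ∸ p)) (λ γ →
         trans (⟦if⟧ (suc a ℕ.≤ᵇ suc p) (X p γ) k β) (cong (λ b → [ b ] * ⟦ X p γ ⟧ k β) (≤ᵇ-suc a p)))) ⟩
  ∑< (suc (a ℕ.+ m)) f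
    ≡⟨ trans (cong (λ n → ∑< n f) (sym (ℕP.+-suc a m))) (∑<-+-split a (suc m) f) ⟩
  ∑< a f + ∑[ j < suc m ] f (a ℕ.+ j)
    ≡⟨ cong₂ _+_ below-a (∑<-cong (suc m) from-a) ⟩
  0ℤ + ∑[ j < suc m ] ∑[ γ ∈ comps (m ∸ j) ] ⟦ negq (m ∸ length γ) (Bt (suc a ℕ.+ j) (Q′ γ)) ⟧ k β
    ≡⟨ ℤP.+-identityˡ _ ⟩
  ∑[ j < suc m ] ∑[ γ ∈ comps (m ∸ j) ] ⟦ negq (m ∸ length γ) (Bt (suc a ℕ.+ j) (Q′ γ)) ⟧ k β ∎
  where
  open ≡-Reasoning
  h : Composition → NSym
  h α = if firstPartGeq (suc a) α then negq (suc ((suc a ℕ.+ m) ∸ suc a) ∸ length α) (Q′ α) else []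
  X : ℕ → Composition → NSym
  X p γ = negq (((a ℕ.+ m) ∸ a) ∸ length γ) (Bt (suc p) (Q′ γ))
  f : ℕ → ℤ
  f p = ∑[ γ ∈ comps ((a ℕ.+ m) ∸ p) ] ([ a ℕ.≤ᵇ p ] * ⟦ X p γ ⟧ k β)
  below-a : ∑< a f ≡ 0ℤ
  below-a = trans (∑<-congᴮ a (λ p p<a →
                    trans (∑-cong (comps ((a ℕ.+ m) ∸ p)) (λ γ → cong (λ b → [ b ] * ⟦ X p γ ⟧ k β) (≤ᵇ-false p<a)))
                                                (∑-0 (comps ((a ℕ.+ m) ∸ p)))))
                  (∑<-0 a)
  from-a : ∀ j → f (a ℕ.+ j) ≡ ∑[ γ ∈ comps (m ∸ j) ] ⟦ negq (m ∸ length γ) (Bt (suc a ℕ.+ j) (Q′ γ)) ⟧ k β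
  from-a j = begin
    ∑[ γ ∈ comps ((a ℕ.+ m) ∸ (a ℕ.+ j)) ] ([ a ℕ.≤ᵇ (a ℕ.+ j) ] * ⟦ X (a ℕ.+ j) γ ⟧ k β)
      ≡⟨ cong (λ n → ∑[ γ ∈ comps n ] ([ a ℕ.≤ᵇ (a ℕ.+ j) ] * ⟦ X (a ℕ.+ j) γ ⟧ k β)) (ℕP.[m+n]∸[m+o]≡n∸o a m j) ⟩
    ∑[ γ ∈ comps (m ∸ j) ] ([ a ℕ.≤ᵇ (a ℕ.+ j) ] * ⟦ X (a ℕ.+ j) γ ⟧ k β)
      ≡⟨ ∑-cong (comps (m ∸ j)) (λ γ → trans (cong (λ b → [ b ] * ⟦ X (a ℕ.+ j) γ ⟧ k β) (≤ᵇ-true (ℕP.m≤m+n a j)))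
           (trans (ℤP.*-identityˡ _) (cong (λ n → ⟦ negq (n ∸ length γ) (Bt (suc a ℕ.+ j) (Q′ γ)) ⟧ k β) (ℕP.m+n∸m≡n a m)))) ⟩
    ∑[ γ ∈ comps (m ∸ j) ] ⟦ negq (m ∸ length γ) (Bt (suc a ℕ.+ j) (Q′ γ)) ⟧ k β ∎

⟦hookSum-rhsAll⟧ : ∀ a m k β → ⟦ hookSum a m rhsAll ⟧ k β
                   ≡ ∑[ j < suc m ] ∑[ γ ∈ comps (m ∸ j) ] ⟦ negq (m ∸ length γ) (Bt (suc a ℕ.+ j) (Q′ γ)) ⟧ k β
⟦hookSum-rhsAll⟧ a m k β = trans (⟦hookSum⟧ a m rhsAll k β) (∑<-congᴮ (suc m) (λ j j<1+m → summand j (ℕP.≤-pred j<1+m)))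
  where
  summand : ∀ j → j ≤ m → sgn j * shift j ⟦ Bt (suc a ℕ.+ j) (rhsAll (m ∸ j)) ⟧ k β
                          ≡ ∑[ γ ∈ comps (m ∸ j) ] ⟦ negq (m ∸ length γ) (Bt (suc a ℕ.+ j) (Q′ γ)) ⟧ k β
  summand j j≤m = begin
    sgn j * shift j ⟦ Bt c (rhsAll r) ⟧ k β
      ≡⟨ cong (sgn j *_) (shift-cong j (λ k′ β′ → trans (⟦ext-concatMap⟧ (BtB c) (λ γ → negq (e γ) (Q′ γ)) (comps r) k′ β′)
           (∑-cong (comps r) (λ γ → ⟦ext-scale⟧ (BtB c) (sgn (e γ)) (e γ) (Q′ γ) k′ β′))) k β) ⟩
    sgn j * shift j (λ k′ β′ → ∑[ γ ∈ comps r ] (sgn (e γ) * shift (e γ) ⟦ Bt c (Q′ γ) ⟧ k′ β′)) k β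
      ≡⟨ cong (sgn j *_) (shift-∑ j (comps r) (sgn ∘ e) (λ γ → shift (e γ) ⟦ Bt c (Q′ γ) ⟧) k β) ⟩
    sgn j * ∑[ γ ∈ comps r ] (sgn (e γ) * shift j (shift (e γ) ⟦ Bt c (Q′ γ) ⟧) k β)
      ≡⟨ sym (∑-*ˡ (comps r) (sgn j) _) ⟩
    ∑[ γ ∈ comps r ] (sgn j * (sgn (e γ) * shift j (shift (e γ) ⟦ Bt c (Q′ γ) ⟧) k β))
      ≡⟨ ∑-congᴬ (comps-sound r) (λ γ (pos , |γ|) → begin
           sgn j * (sgn (e γ) * shift j (shift (e γ) ⟦ Bt c (Q′ γ) ⟧) k β)
             ≡⟨ sym (ℤP.*-assoc (sgn j) (sgn (e γ)) _) ⟩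
           (sgn j * sgn (e γ)) * shift j (shift (e γ) ⟦ Bt c (Q′ γ) ⟧) k β
             ≡⟨ cong₂ _*_ (sym (sgn-+ j (e γ))) (sym (shift-shift j (e γ) _ k β)) ⟩
           sgn (j ℕ.+ e γ) * shift (j ℕ.+ e γ) ⟦ Bt c (Q′ γ) ⟧ k β
             ≡⟨ cong (λ n → sgn n * shift n ⟦ Bt c (Q′ γ) ⟧ k β) (exponent γ (subst (length γ ≤_) |γ| (length≤size γ pos))) ⟩
           sgn (m ∸ length γ) * shift (m ∸ length γ) ⟦ Bt c (Q′ γ) ⟧ k β
             ≡⟨ sym (⟦scale⟧ (sgn (m ∸ length γ)) (m ∸ length γ) (Bt c (Q′ γ)) k β) ⟩
           ⟦ negq (m ∸ length γ) (Bt c (Q′ γ)) ⟧ k β ∎) ⟩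
    ∑[ γ ∈ comps r ] ⟦ negq (m ∸ length γ) (Bt c (Q′ γ)) ⟧ k β ∎
    where
    open ≡-Reasoning
    c = suc a ℕ.+ j
    r = m ∸ j
    e : Composition → ℕ
    e γ = r ∸ length γ
    exponent : ∀ γ → length γ ≤ r → j ℕ.+ e γ ≡ m ∸ length γ
    exponent γ ℓ≤r = trans (sym (ℕP.+-∸-assoc j ℓ≤r)) (cong (_∸ length γ) (ℕP.m+[n∸m]≡n j≤m))

rhsHook≈hookSum : ∀ a m → rhsHook (suc a ℕ.+ m) (suc a) ≈ hookSum a m rhsAll
rhsHook≈hookSum a m k β = trans (⟦rhsHook⟧ a m k β) (sym (⟦hookSum-rhsAll⟧ a m k β))

rhsHook-one : ∀ n → rhsHook (suc n) 1 ≈ rhsAll (suc n)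
rhsHook-one n k β =
  trans (⟦concatMap⟧ hook (comps (suc n)) k β)
        (trans (∑-congᴬ (comps-sound (suc n)) same) (sym (⟦concatMap⟧ all (comps (suc n)) k β)))
  where
  hook all : Composition → NSym
  hook α = if firstPartGeq 1 α then negq (suc (suc n ∸ 1) ∸ length α) (Q′ α) else []
  all  α = negq (suc n ∸ length α) (Q′ α)
  same : ∀ α → IsCompositionOf (suc n) α → ⟦ hook α ⟧ k β ≡ ⟦ all α ⟧ k β
  same []          (_ , ())
  same (zero ∷ α)  (() , _)
  same (suc x ∷ α) _ = refl

rhsAll≈Λ : ∀ n → rhsAll n ≈ Λ n
rhsAll≈Λ n = bounded n n ℕP.≤-refl
  where
  bounded : ∀ N n → n ≤ N → rhsAll n ≈ Λ n
  bounded N       zero    _         k β = refl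
  bounded (suc N) (suc m) (s≤s m≤N) = begin
    rhsAll (suc m)         ≈⟨ rhsHook-one m ⟨
    rhsHook (suc m) 1      ≈⟨ rhsHook≈hookSum 0 m ⟩
    hookSum 0 m rhsAll     ≈⟨ hookSum-cong 0 m rhsAll Λ (λ j → bounded N (m ∸ j) (ℕP.≤-trans (ℕP.m∸n≤m m j) m≤N)) ⟩
    hookSum 0 m Λ          ≈⟨ B-Λ-expansion 0 m ⟨
    B 1 (Λ m)              ≈⟨ B1-Λ m ⟩
    Λ (suc m)              ∎
    where open SetoidReasoning ≈-setoid

𝔖-ones≈rhsAll : ∀ n → 𝔖 (replicate n 1) ≈ rhsAll n
𝔖-ones≈rhsAll n = begin
  𝔖 (replicate n 1) ≈⟨ 𝔖-ones n ⟩
  Λ n               ≈⟨ rhsAll≈Λ n ⟨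
  rhsAll n          ∎
  where open SetoidReasoning ≈-setoid

𝔖-hook : ∀ n k → 1 ≤ k → k ≤ n → 𝔖 (k ∷ replicate (n ∸ k) 1) ≈ rhsHook n k
𝔖-hook n (suc a) _ k≤n = subst (λ n′ → 𝔖 (suc a ∷ replicate m 1) ≈ rhsHook n′ (suc a)) (ℕP.m+[n∸m]≡n k≤n) (begin
  B (suc a) (𝔖 (replicate m 1))   ≈⟨ B-cong (suc a) (𝔖 (replicate m 1)) (Λ m) (𝔖-ones m) ⟩
  B (suc a) (Λ m)                 ≈⟨ B-Λ-expansion a m ⟩
  hookSum a m Λ                   ≈⟨ hookSum-cong a m rhsAll Λ (λ j → rhsAll≈Λ (m ∸ j)) ⟨
  hookSum a m rhsAll              ≈⟨ rhsHook≈hookSum a m ⟨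
  rhsHook (suc a ℕ.+ m) (suc a)   ∎)
  where
  open SetoidReasoning ≈-setoid
  m : ℕ
  m = n ∸ suc a

proposition4p14 :
    (∀ (n : ℕ) → 1 ≤ n → 𝔖 (replicate n 1) ≈ rhsAll n)
    × (∀ (n k : ℕ) → 1 ≤ k → k ≤ n → 𝔖 (k ∷ replicate (n ∸ k) 1) ≈ rhsHook n k)
proposition4p14 = (λ n _ → 𝔖-ones≈rhsAll n) , 𝔖-hook
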